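{- Let $n\ge0$. Then $\mathcal{C}_n(\mathfrak{H})$ and $\bar{\mathcal{C}}_n(\mathfrak{H})$ are contained in $x\mathfrak{H}\otimes\mathfrak{H}^{\otimes n}\otimes\mathfrak{H}y$, and the following hold: (i) $(\gamma\otimes\gamma^{\otimes n}\otimes d)\circ\bar{\mathcal{C}}_n=\mathcal{C}_n$; (ii) $d\circ M_n=M_n\circ(\gamma\otimes\gamma^{\otimes n}\otimes d)$ on $x\mathfrak{H}\otimes\mathfrak{H}^{\otimes n}\otimes\mathfrak{H}y$; (iii) $d\circ\bar{\rho}_n=\rho_n$; (iv) $\bar{Z}=Z\circ d$ on $\mathfrak{H}^0$, where $d$ restricts to a $\mathbb{Q}$-linear automorphism of $\mathfrak{H}^0$ and $\gamma\otimes\gamma^{\otimes n}\otimes d$ is a $\mathbb{Q}$-linear automorphism of $x\mathfrak{H}\otimes\mathfrak{H}^{\otimes n}\otimes\mathfrak{H}y$.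
   Context: Let $\mathfrak{H}=\mathbb{Q}\langle x,y\rangle$ be the noncommutative polynomial algebra over $\mathbb{Q}$ in $x,y$; $z=x+y$, $z_k=x^{k-1}y$, $\mathfrak{H}^0=\mathbb{Q}+x\mathfrak{H}y$. For integers $k_1\ge2$, $k_2,\dots,k_l\ge1$, $\zeta(k_1,\dots,k_l)=\sum_{n_1>\cdots>n_l\ge1}n_1^{ -k_1}\cdots n_l^{ -k_l}$ and $\zeta^{\star}(k_1,\dots,k_l)=\sum_{n_1\ge\cdots\ge n_l\ge1}n_1^{ -k_1}\cdots n_l^{ -k_l}$. $Z,\bar{Z}\colon\mathfrak{H}^0\to\mathbb{R}$ are the $\mathbb{Q}$-linear maps with $Z(1)=\bar{Z}(1)=1$, $Z(z_{k_1}\cdots z_{k_l})=\zeta(k_1,\dots,k_l)$, $\bar{Z}(z_{k_1}\cdots z_{k_l})=\zeta^{\star}(k_1,\dots,k_l)$ ($k_1\ge2$). Let $\gamma$ be the algebra automorphism of $\mathfrak{H}$ with $\gamma(x)=x$, $\gamma(y)=z$, and $d$ the $\mathbb{Q}$-linear map on $\mathbb{Q}+\mathfrak{H}y$ with $d(1)=1$, $d(wy)=\gamma(w)y$. For $n\ge0$, make $\mathfrak{H}^{\otimes(n+2)}$ an $\mathfrak{H}$-bimodule via $a\diamond(w_1\otimes\cdots\otimes w_{n+2})\diamond b=w_1b\otimes w_2\otimes\cdots\otimes w_{n+1}\otimes aw_{n+2}$, and let $M_n(w_1\otimes\cdots\otimes w_{n+2})=w_1\cdots w_{n+2}$. $\mathcal{C}_n$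 is the $\mathbb{Q}$-linear map $\mathfrak{H}\to\mathfrak{H}^{\otimes(n+2)}$ with $\mathcal{C}_n(1)=0$, $\mathcal{C}_n(x)=x\otimes z^{\otimes n}\otimes y$, $\mathcal{C}_n(y)=-x\otimes z^{\otimes n}\otimes y$, $\mathcal{C}_n(ww')=\mathcal{C}_n(w)\diamond w'+w\diamond\mathcal{C}_n(w')$; $\rho_n=M_n\circ\mathcal{C}_n$. $\bar{\mathcal{C}}_n$ is the $\mathbb{Q}$-linear map with $\bar{\mathcal{C}}_n(1)=0$, $\bar{\mathcal{C}}_n(x)=x\otimes y^{\otimes(n+1)}$, $\bar{\mathcal{C}}_n(y)=-x\otimes y^{\otimes(n+1)}$, $\bar{\mathcal{C}}_n(ww')=\bar{\mathcal{C}}_n(w)\diamond\gamma^{ -1}(w')+\gamma^{ -1}(w)\diamond\bar{\mathcal{C}}_n(w')$; $\bar{\rho}_n=M_n\circ\bar{\mathcal{C}}_n$. -}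

module Defs where

open import Data.Nat as ℕ using (ℕ; zero; suc; _^_)
open import Data.Nat.Properties using (m^n≢0)
open import Data.Integer using (+_)
open import Data.Rational using (ℚ; 0ℚ; 1ℚ; _+_; _*_; -_; _-_; ∣_∣; _<_; _/_)
open import Data.List as L using (List; []; _∷_; _++_; [_])
open import Data.List.Properties as LP using ()
open import Data.Vec as V using (Vec; []; _∷_)
open import Data.Vec.Properties as VP using ()
open import Data.Product using (_×_; _,_; Σ; ∃)
open import Data.Product.Properties as PP using ()
open import Data.Maybe using (Maybe; just; nothing)
open import Relation.Nullary using (yes; no; ¬_)
open import Relation.Binary.Definitions using (DecidableEquality)
open import Relation.Binary.PropositionalEquality using (_≡_; refl)
open import Data.Sum using (_⊎_)

-- Words in the letters x, y  (monomials of 𝔥 = ℚ⟨x,y⟩)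

data Letter : Set where
  X Y : Letter

_≟L_ : DecidableEquality Letter
X ≟L X = yes refl
X ≟L Y = no λ ()
Y ≟L X = no λ ()
Y ≟L Y = yes refl

Word : Set
Word = List Letter

_≟W_ : DecidableEquality Word
_≟W_ = LP.≡-dec _≟L_

-- Formal ℚ-linear combinations of basis elements (free ℚ-module on A).
-- An element is a finite list of (coefficient , basis element);
-- it is identified with its coefficient function.

Lin : Set → Set
Lin A = List (ℚ × A)

coeff : {A : Set} → DecidableEquality A → Lin A → A → ℚ
coeff _≟_ [] b = 0ℚ
coeff _≟_ ((c , a) ∷ p) b with a ≟ b
... | yes _ = c + coeff _≟_ p b
... | no  _ = coeff _≟_ p b

Eq : {A : Set} → DecidableEquality A → Lin A → Lin A → Set
Eq _≟_ p q = ∀ b → coeff _≟_ p b ≡ coeff _≟_ q b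

InSpan : {A : Set} → DecidableEquality A → (A → Set) → Lin A → Set
InSpan _≟_ P p = ∀ b → ¬ (coeff _≟_ p b ≡ 0ℚ) → P b

pure : {A : Set} → A → Lin A
pure a = [ (1ℚ , a) ]

scale : {A : Set} → ℚ → Lin A → Lin A
scale c = L.map (λ { (d , a) → (c * d , a) })

neg : {A : Set} → Lin A → Lin A
neg = scale (- 1ℚ)

ext : {A B : Set} → (A → Lin B) → Lin A → Lin B
ext f [] = []
ext f ((c , a) ∷ p) = scale c (f a) ++ ext f p

extℚ : {A : Set} → (A → ℚ) → Lin A → ℚ
extℚ f [] = 0ℚ
extℚ f ((c , a) ∷ p) = c * f a + extℚ f p

bilin : {A B C : Set} → (A → B → C) → Lin A → Lin B → Lin C
bilin f p q = ext (λ a → ext (λ b → pure (f a b)) q) p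

H : Set
H = Lin Word

_≈H_ : H → H → Set
_≈H_ = Eq _≟W_

_·_ : H → H → H
_·_ = bilin _++_

xH yH zH : H
xH = pure (X ∷ [])
yH = pure (Y ∷ [])
zH = xH ++ yH

γL γinvL : Letter → H
γL X = xH
γL Y = zH
γinvL X = xH
γinvL Y = yH ++ neg xH

algMap : (Letter → H) → Word → H
algMap f [] = pure []
algMap f (a ∷ w) = f a · algMap f w

γW γinvW : Word → H
γW = algMap γL
γinvW = algMap γinvL

γ γinv : H → H
γ = ext γW
γinv = ext γinvW

-- d on ℚ + 𝔥y :  d(1) = 1,  d(wy) = γ(w)y.
-- (On monomials ending in x, which lie outside the domain, d is set to 0;
--  the statements below only apply d inside its domain.)
dW : Word → H
dW w with L.unsnoc w
... | nothing = pure []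
... | just (u , X) = []
... | just (u , Y) = γW u · yH

d : H → H
d = ext dW

EndsY : Word → Set
EndsY w = ∃ λ u → w ≡ u ++ (Y ∷ [])

StartsX : Word → Set
StartsX w = ∃ λ u → w ≡ X ∷ u

InH0 : H → Set
InH0 = InSpan _≟W_ (λ w → (w ≡ []) ⊎ (StartsX w × EndsY w))

-- 𝔥^{⊗(n+2)} = 𝔥 ⊗ 𝔥^{⊗n} ⊗ 𝔥, with basis  Word × Vec Word n × Word

Basis : ℕ → Set
Basis n = Word × Vec Word n × Word

_≟B_ : ∀ {n} → DecidableEquality (Basis n)
_≟B_ = PP.≡-dec _≟W_ (PP.≡-dec (VP.≡-dec _≟W_) _≟W_)

T : ℕ → Set
T n = Lin (Basis n)

_≈T_ : ∀ {n} → T n → T n → Set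
_≈T_ = Eq _≟B_

tensorV : ∀ {n} → Vec H n → Lin (Vec Word n)
tensorV [] = pure []
tensorV (p ∷ ps) = bilin _∷_ p (tensorV ps)

tensor : ∀ {n} → H → Vec H n → H → T n
tensor p ps q = bilin _,_ p (bilin _,_ (tensorV ps) q)

-- bimodule structure: a ⋄ (w₁ ⊗ ⋯ ⊗ w_{n+2}) ⋄ b = w₁b ⊗ w₂ ⊗ ⋯ ⊗ w_{n+1} ⊗ a w_{n+2}
_⋄ˡ_ : ∀ {n} → H → T n → T n
a ⋄ˡ t = bilin (λ u → λ { (w₁ , v , w₂) → (w₁ , v , u ++ w₂) }) a t

_⋄ʳ_ : ∀ {n} → T n → H → T n
t ⋄ʳ b = bilin (λ { (w₁ , v , w₂) → λ u → (w₁ ++ u , v , w₂) }) t b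

MB : ∀ {n} → Basis n → Word
MB (w₁ , v , w₂) = w₁ ++ L.concat (V.toList v) ++ w₂

M : ∀ {n} → T n → H
M = ext (λ b → pure (MB b))

InSub : ∀ {n} → T n → Set
InSub = InSpan _≟B_ (λ { (w₁ , v , w₂) → StartsX w₁ × EndsY w₂ })

Φ : ∀ {n} → T n → T n
Φ = ext (λ { (w₁ , v , w₂) → tensor (γW w₁) (V.map γW v) (dW w₂) })

cLetter : ∀ n → Letter → T n
cLetter n X = tensor xH (V.replicate n zH) yH
cLetter n Y = neg (tensor xH (V.replicate n zH) yH)

cbarLetter : ∀ n → Letter → T n
cbarLetter n X = tensor xH (V.replicate n yH) yH
cbarLetter n Y = neg (tensor xH (V.replicate n yH) yH)

CW : ∀ n → Word → T n
CW n [] = []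
CW n (a ∷ w) = (cLetter n a ⋄ʳ pure w) ++ (pure (a ∷ []) ⋄ˡ CW n w)

CbarW : ∀ n → Word → T n
CbarW n [] = []
CbarW n (a ∷ w) = (cbarLetter n a ⋄ʳ γinvW w) ++ (γinvL a ⋄ˡ CbarW n w)

C Cbar : ∀ n → H → T n
C n = ext (CW n)
Cbar n = ext (CbarW n)

ρ ρbar : ∀ n → H → H
ρ n p = M (C n p)
ρbar n p = M (Cbar n p)

-- Multiple zeta (star) values via their partial sums.
-- indices: z_{k₁}⋯z_{k_l} ↦ (k₁,…,k_l); words ending in x have no index.

indices : Word → Maybe (List ℕ)
indices [] = just []
indices (X ∷ w) with indices w
... | just (k ∷ ks) = just (suc k ∷ ks)
... | _ = nothing
indices (Y ∷ w) with indices w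
... | just ks = just (1 ∷ ks)
... | nothing = nothing

inv^ : ℕ → ℕ → ℚ
inv^ m k = _/_ (+ 1) (suc m ^ k) {{m^n≢0 (suc m) k}}   -- = (m+1)^{-k}

-- Σ_{N ≥ n₁ > ⋯ > n_l ≥ 1} Π n_i^{-k_i}
ζN : ℕ → List ℕ → ℚ
ζN N [] = 1ℚ
ζN zero (k ∷ ks) = 0ℚ
ζN (suc N) (k ∷ ks) = inv^ N k * ζN N ks + ζN N (k ∷ ks)

-- Σ_{N ≥ n₁ ≥ ⋯ ≥ n_l ≥ 1} Π n_i^{-k_i}
ζ⋆N : ℕ → List ℕ → ℚ
ζ⋆N N [] = 1ℚ
ζ⋆N zero (k ∷ ks) = 0ℚ
ζ⋆N (suc N) (k ∷ ks) = inv^ N k * ζ⋆N (suc N) ks + ζ⋆N N (k ∷ ks)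

onIndices : (ℕ → List ℕ → ℚ) → ℕ → Word → ℚ
onIndices f N w with indices w
... | just ks = f N ks
... | nothing = 0ℚ

ZN Z̄N : ℕ → H → ℚ
ZN N = extℚ (onIndices ζN N)
Z̄N N = extℚ (onIndices ζ⋆N N)

TendsToZero : (ℕ → ℚ) → Set
TendsToZero a = ∀ (ε : ℚ) → 0ℚ < ε → ∃ λ N₀ → ∀ N → N₀ ℕ.≤ N → ∣ a N ∣ < ε

{-# OPTIONS --safe #-}
module Submission where

-- Every map here is defined on words and extended linearly, so each identity is checked on
-- basis elements. γ and γ⁻¹ are algebra maps inverse to each other on letters, hence on words.
-- Building d, and Φ = γ ⊗ γ^{⊗n} ⊗ d, from an arbitrary algebra map in place of γ, the same
-- construction with γ⁻¹ inverts them on 𝔥⁰ and on x𝔥 ⊗ 𝔥^{⊗n} ⊗ 𝔥y. Φ intertwines the two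
-- bimodule actions, twisting them by γ, and γ∘γ⁻¹ = id turns the Leibniz rule of 𝒞̄ into that
-- of 𝒞, which gives (i) by induction on words; (ii) is d(uw) = γ(u)d(w) for w ending in y, and
-- (iii) combines the two. For (iv) the partial sums agree exactly: expanding γ(y) = x + y,
-- d(z_{k₁}⋯z_{k_l}) is the sum of z-words over all ways of merging runs of consecutive indices,
-- which is how ζ⋆_N decomposes into ζ_N according to which of the n_i coincide.

open import Defs
open import Data.Nat as ℕ using (ℕ; zero; suc; _≤_; z≤n; s≤s)
import Data.Nat.Properties as ℕP
import Data.Nat.GCD as ℕG
import Data.Integer as ℤ
import Data.Integer.Properties as ℤP
open import Data.Rational as ℚ using (ℚ; mkℚ; ↥_; ↧_; ↧ₙ_; 0ℚ; 1ℚ; _+_; _*_; -_; _-_)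
import Data.Rational.Properties as ℚP
import Algebra.Properties.Group ℚP.+-0-group as ℚ+
open import Data.List as L using (List; []; _∷_; _++_; _∷ʳ′_)
import Data.List.Properties as LP
open import Data.Vec as V using (Vec; []; _∷_)
import Data.Vec.Properties as VP
open import Data.Vec.Relation.Binary.Pointwise.Inductive as Pointwise using (Pointwise; []; _∷_)
open import Data.Product using (_×_; _,_; ∃; proj₂)
import Data.Product.Properties as PP
open import Data.Sum using (_⊎_; inj₁; inj₂)
open import Data.Unit using (⊤; tt)
open import Data.Empty using (⊥-elim)
open import Data.Maybe as Maybe using (Maybe; just; nothing)
open import Relation.Nullary using (yes; no; ¬_; Dec)
open import Relation.Nullary.Decidable using (_×-dec_; _⊎-dec_)
open import Relation.Binary.Definitions using (DecidableEquality)
open import Relation.Binary.Bundles using (Setoid)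
open import Level using (0ℓ)
open import Function using (_∘_)
open import Relation.Binary.PropositionalEquality
import Relation.Binary.Reasoning.Setoid as SetoidReasoning
open import Tactic.RingSolver using (solve-∀)
open import Tactic.RingSolver.Core.AlmostCommutativeRing using (AlmostCommutativeRing; fromCommutativeRing)

ℚ-ring : AlmostCommutativeRing 0ℓ 0ℓ
ℚ-ring = fromCommutativeRing ℚP.+-*-commutativeRing zero?
  where
  zero? : ∀ x → Maybe (0ℚ ≡ x)
  zero? x with 0ℚ ℚ.≟ x
  ... | yes p = just p
  ... | no _  = nothing

-1*x≡-x : ∀ x → (- 1ℚ) * x ≡ - x
-1*x≡-x = solve-∀ ℚ-ring

-- Linear combinations

module _ {A : Set} where

  extℚ-++ : (g : A → ℚ) (p q : Lin A) → extℚ g (p ++ q) ≡ extℚ g p + extℚ g q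
  extℚ-++ g []            q = sym (ℚP.+-identityˡ _)
  extℚ-++ g ((c , a) ∷ p) q rewrite extℚ-++ g p q = sym (ℚP.+-assoc (c * g a) _ _)

  extℚ-scale : (g : A → ℚ) (c : ℚ) (p : Lin A) → extℚ g (scale c p) ≡ c * extℚ g p
  extℚ-scale g c []            = sym (ℚP.*-zeroʳ c)
  extℚ-scale g c ((d , a) ∷ p) rewrite extℚ-scale g c p = lemma c d (g a) (extℚ g p)
    where lemma : ∀ c d x y → c * d * x + c * y ≡ c * (d * x + y)
          lemma = solve-∀ ℚ-ring

  extℚ-pure : (g : A → ℚ) (a : A) → extℚ g (pure a) ≡ g a
  extℚ-pure g a = lemma (g a)
    where lemma : ∀ x → 1ℚ * x + 0ℚ ≡ x
          lemma = solve-∀ ℚ-ring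

  extℚ-cong : {g h : A → ℚ} → (∀ a → g a ≡ h a) → (p : Lin A) → extℚ g p ≡ extℚ h p
  extℚ-cong g≡h []            = refl
  extℚ-cong g≡h ((c , a) ∷ p) = cong₂ (λ u v → c * u + v) (g≡h a) (extℚ-cong g≡h p)

  extℚ-+ : (g h : A → ℚ) (p : Lin A) → extℚ (λ a → g a + h a) p ≡ extℚ g p + extℚ h p
  extℚ-+ g h []            = sym (ℚP.+-identityˡ 0ℚ)
  extℚ-+ g h ((c , a) ∷ p) rewrite extℚ-+ g h p = lemma c (g a) (h a) (extℚ g p) (extℚ h p)
    where lemma : ∀ c x y u v → c * (x + y) + (u + v) ≡ c * x + u + (c * y + v)
          lemma = solve-∀ ℚ-ring

  extℚ-* : (k : ℚ) (g : A → ℚ) (p : Lin A) → extℚ (λ a → k * g a) p ≡ k * extℚ g p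
  extℚ-* k g []            = sym (ℚP.*-zeroʳ k)
  extℚ-* k g ((c , a) ∷ p) rewrite extℚ-* k g p = lemma k c (g a) (extℚ g p)
    where lemma : ∀ k c x u → c * (k * x) + k * u ≡ k * (c * x + u)
          lemma = solve-∀ ℚ-ring

  extℚ-zero : (p : Lin A) → extℚ (λ _ → 0ℚ) p ≡ 0ℚ
  extℚ-zero []            = refl
  extℚ-zero ((c , a) ∷ p) rewrite extℚ-zero p = lemma c
    where lemma : ∀ c → c * 0ℚ + 0ℚ ≡ 0ℚ
          lemma = solve-∀ ℚ-ring

  extℚ-neg : (g : A → ℚ) (p : Lin A) → extℚ (λ a → - g a) p ≡ - extℚ g p
  extℚ-neg g []            = refl
  extℚ-neg g ((c , a) ∷ p) rewrite extℚ-neg g p = lemma c (g a) (extℚ g p)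
    where lemma : ∀ c x u → c * (- x) + (- u) ≡ - (c * x + u)
          lemma = solve-∀ ℚ-ring

module _ {A B : Set} where

  extℚ-comm : (k : A → B → ℚ) (p : Lin A) (q : Lin B) →
    extℚ (λ a → extℚ (k a) q) p ≡ extℚ (λ b → extℚ (λ a → k a b) p) q
  extℚ-comm k []            q = sym (extℚ-zero q)
  extℚ-comm k ((c , a) ∷ p) q = begin
      c * extℚ (k a) q + extℚ (λ a → extℚ (k a) q) p
    ≡⟨ cong₂ _+_ (sym (extℚ-* c (k a) q)) (extℚ-comm k p q) ⟩
      extℚ (λ b → c * k a b) q + extℚ (λ b → extℚ (λ a → k a b) p) q
    ≡⟨ sym (extℚ-+ _ _ q) ⟩
      extℚ (λ b → c * k a b + extℚ (λ a → k a b) p) q ∎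
    where open ≡-Reasoning

  extℚ-ext : (g : B → ℚ) (f : A → Lin B) (p : Lin A) →
    extℚ g (ext f p) ≡ extℚ (λ a → extℚ g (f a)) p
  extℚ-ext g f []            = refl
  extℚ-ext g f ((c , a) ∷ p) = begin
      extℚ g (scale c (f a) ++ ext f p)
    ≡⟨ extℚ-++ g (scale c (f a)) (ext f p) ⟩
      extℚ g (scale c (f a)) + extℚ g (ext f p)
    ≡⟨ cong₂ _+_ (extℚ-scale g c (f a)) (extℚ-ext g f p) ⟩
      c * extℚ g (f a) + extℚ (λ a → extℚ g (f a)) p ∎
    where open ≡-Reasoning

  ext-++ : (f : A → Lin B) (p q : Lin A) → ext f (p ++ q) ≡ ext f p ++ ext f q
  ext-++ f []            q = refl
  ext-++ f ((c , a) ∷ p) q rewrite ext-++ f p q = sym (LP.++-assoc (scale c (f a)) (ext f p) (ext f q))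

module _ {A : Set} (e : DecidableEquality A) where

  coeff-++ : ∀ (p q : Lin A) b → coeff e (p ++ q) b ≡ coeff e p b + coeff e q b
  coeff-++ []            q b = sym (ℚP.+-identityˡ _)
  coeff-++ ((c , a) ∷ p) q b with e a b
  ... | yes _ rewrite coeff-++ p q b = sym (ℚP.+-assoc c _ _)
  ... | no  _ = coeff-++ p q b

  coeff-scale : ∀ c (p : Lin A) b → coeff e (scale c p) b ≡ c * coeff e p b
  coeff-scale c []            b = sym (ℚP.*-zeroʳ c)
  coeff-scale c ((d , a) ∷ p) b with e a b
  ... | yes _ rewrite coeff-scale c p b = sym (ℚP.*-distribˡ-+ c d _)
  ... | no  _ = coeff-scale c p b

  coeff-neg : ∀ (p : Lin A) b → coeff e (neg p) b ≡ - coeff e p b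
  coeff-neg p b = trans (coeff-scale (- 1ℚ) p b) (-1*x≡-x (coeff e p b))

  erase : A → Lin A → Lin A
  erase a [] = []
  erase a ((c , a′) ∷ p) with e a′ a
  ... | yes _ = erase a p
  ... | no  _ = (c , a′) ∷ erase a p

  length-erase : ∀ a p → L.length (erase a p) ≤ L.length p
  length-erase a [] = z≤n
  length-erase a ((c , a′) ∷ p) with e a′ a
  ... | yes _ = ℕP.m≤n⇒m≤1+n (length-erase a p)
  ... | no  _ = s≤s (length-erase a p)

  coeff-erase-self : ∀ a p → coeff e (erase a p) a ≡ 0ℚ
  coeff-erase-self a [] = refl
  coeff-erase-self a ((c , a′) ∷ p) with e a′ a
  ... | yes _ = coeff-erase-self a p
  ... | no a′≢a with e a′ a
  ...   | yes a′≡a = ⊥-elim (a′≢a a′≡a)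
  ...   | no  _    = coeff-erase-self a p

  coeff-erase-other : ∀ a b p → ¬ a ≡ b → coeff e (erase a p) b ≡ coeff e p b
  coeff-erase-other a b [] a≢b = refl
  coeff-erase-other a b ((c , a′) ∷ p) a≢b with e a′ a
  ... | yes refl with e a′ b
  ...   | yes a≡b = ⊥-elim (a≢b a≡b)
  ...   | no  _   = coeff-erase-other a b p a≢b
  coeff-erase-other a b ((c , a′) ∷ p) a≢b | no _ with e a′ b
  ...   | yes _ = cong (c +_) (coeff-erase-other a b p a≢b)
  ...   | no  _ = coeff-erase-other a b p a≢b

  extℚ-erase : (g : A → ℚ) (a : A) (p : Lin A) → extℚ g p ≡ coeff e p a * g a + extℚ g (erase a p)
  extℚ-erase g a [] = sym (trans (cong (_+ 0ℚ) (ℚP.*-zeroˡ (g a))) (ℚP.+-identityʳ 0ℚ))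
  extℚ-erase g a ((c , a′) ∷ p) with e a′ a
  ... | yes refl rewrite extℚ-erase g a p = lemma c (coeff e p a) (g a) (extℚ g (erase a p))
    where lemma : ∀ c k x u → c * x + (k * x + u) ≡ (c + k) * x + u
          lemma = solve-∀ ℚ-ring
  ... | no _ rewrite extℚ-erase g a p = lemma c (g a′) (coeff e p a) (g a) (extℚ g (erase a p))
    where lemma : ∀ c y k x u → c * y + (k * x + u) ≡ k * x + (c * y + u)
          lemma = solve-∀ ℚ-ring

  -- Induction on the number of terms, erasing one basis element at a time.
  extℚ-vanishes : (g : A → ℚ) (p : Lin A) → (∀ a → coeff e p a ≡ 0ℚ ⊎ g a ≡ 0ℚ) → extℚ g p ≡ 0ℚ
  extℚ-vanishes g p = go (L.length p) p ℕP.≤-refl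
    where
    go : ∀ n p → L.length p ≤ n → (∀ a → coeff e p a ≡ 0ℚ ⊎ g a ≡ 0ℚ) → extℚ g p ≡ 0ℚ
    go n       []                   _           _      = refl
    go (suc n) p@((c , a) ∷ p′) (s≤s |p′|≤n) vanish = begin
        extℚ g p                                ≡⟨ extℚ-erase g a p ⟩
        coeff e p a * g a + extℚ g (erase a p)  ≡⟨ cong₂ _+_ head-vanishes (cong (extℚ g) erase-head) ⟩
        0ℚ + extℚ g (erase a p′)                ≡⟨ cong (0ℚ +_) rest-vanishes ⟩
        0ℚ + 0ℚ                                 ≡⟨⟩
        0ℚ                                      ∎
      where
      open ≡-Reasoning
      head-vanishes : coeff e p a * g a ≡ 0ℚ
      head-vanishes with vanish a
      ... | inj₁ z rewrite z = ℚP.*-zeroˡ (g a)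
      ... | inj₂ z rewrite z = ℚP.*-zeroʳ (coeff e p a)
      erase-head : erase a p ≡ erase a p′
      erase-head with e a a
      ... | yes _  = refl
      ... | no a≢a = ⊥-elim (a≢a refl)
      vanish′ : ∀ b → coeff e (erase a p′) b ≡ 0ℚ ⊎ g b ≡ 0ℚ
      vanish′ b with e a b | vanish b
      ... | yes refl | _      = inj₁ (coeff-erase-self a p′)
      ... | no _     | inj₂ z = inj₂ z
      ... | no a≢b   | inj₁ z = inj₁ (trans (coeff-erase-other a b p′ a≢b) z)
      rest-vanishes : extℚ g (erase a p′) ≡ 0ℚ
      rest-vanishes = go n (erase a p′) (ℕP.≤-trans (length-erase a p′) |p′|≤n) vanish′

infix 4 _≋[_]_

-- `Eq e p q` is a function type, from which p and q cannot be inferred; the record can.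
record _≋[_]_ {A : Set} (p : Lin A) (e : DecidableEquality A) (q : Lin A) : Set where
  constructor mk≋
  field coeff-≡ : Eq e p q
open _≋[_]_ public

module _ {A : Set} {e : DecidableEquality A} where

  ≋-refl : {p : Lin A} → p ≋[ e ] p
  ≋-refl = mk≋ λ _ → refl

  ≋-sym : {p q : Lin A} → p ≋[ e ] q → q ≋[ e ] p
  ≋-sym (mk≋ p≈q) = mk≋ λ b → sym (p≈q b)

  ≋-trans : {p q r : Lin A} → p ≋[ e ] q → q ≋[ e ] r → p ≋[ e ] r
  ≋-trans (mk≋ p≈q) (mk≋ q≈r) = mk≋ λ b → trans (p≈q b) (q≈r b)

  ≡⇒≋ : {p q : Lin A} → p ≡ q → p ≋[ e ] q
  ≡⇒≋ refl = ≋-refl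

  ++-cong : {p p′ q q′ : Lin A} → p ≋[ e ] p′ → q ≋[ e ] q′ → p ++ q ≋[ e ] p′ ++ q′
  ++-cong {p} {p′} {q} {q′} (mk≋ p≈p′) (mk≋ q≈q′) = mk≋ λ b →
    trans (coeff-++ e p q b) (trans (cong₂ _+_ (p≈p′ b) (q≈q′ b)) (sym (coeff-++ e p′ q′ b)))

  scale-cong : ∀ c {p p′ : Lin A} → p ≋[ e ] p′ → scale c p ≋[ e ] scale c p′
  scale-cong c {p} {p′} (mk≋ p≈p′) = mk≋ λ b →
    trans (coeff-scale e c p b) (trans (cong (c *_) (p≈p′ b)) (sym (coeff-scale e c p′ b)))

  neg-cong : {p p′ : Lin A} → p ≋[ e ] p′ → neg p ≋[ e ] neg p′
  neg-cong = scale-cong (- 1ℚ)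

  ++-neg-cancel : (p q : Lin A) → (p ++ q) ++ neg p ≋[ e ] q
  ++-neg-cancel p q = mk≋ λ b → begin
      coeff e ((p ++ q) ++ neg p) b             ≡⟨ coeff-++ e (p ++ q) (neg p) b ⟩
      coeff e (p ++ q) b + coeff e (neg p) b    ≡⟨ cong₂ _+_ (coeff-++ e p q b) (coeff-neg e p b) ⟩
      coeff e p b + coeff e q b - coeff e p b   ≡⟨ x+y-x≡y (coeff e p b) (coeff e q b) ⟩
      coeff e q b                               ∎
    where
    open ≡-Reasoning
    x+y-x≡y : ∀ x y → x + y - x ≡ y
    x+y-x≡y = solve-∀ ℚ-ring

  extℚ-cong-≋ : (g : A → ℚ) {p q : Lin A} → p ≋[ e ] q → extℚ g p ≡ extℚ g q
  extℚ-cong-≋ g {p} {q} (mk≋ p≈q) = ℚ+.x∙y⁻¹≈ε⇒x≈y _ _ (begin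
      extℚ g p - extℚ g q              ≡⟨ cong (extℚ g p +_) (sym (trans (extℚ-scale g (- 1ℚ) q) (-1*x≡-x (extℚ g q)))) ⟩
      extℚ g p + extℚ g (neg q)        ≡⟨ sym (extℚ-++ g p (neg q)) ⟩
      extℚ g (p ++ neg q)              ≡⟨ extℚ-vanishes e g (p ++ neg q) (λ b → inj₁ (p-q≈0 b)) ⟩
      0ℚ                               ∎)
    where
    open ≡-Reasoning
    p-q≈0 : ∀ b → coeff e (p ++ neg q) b ≡ 0ℚ
    p-q≈0 b = trans (coeff-++ e p (neg q) b) (trans (cong₂ _+_ (p≈q b) (coeff-neg e q b)) (ℚP.+-inverseʳ (coeff e q b)))

≋-setoid : {A : Set} → DecidableEquality A → Setoid 0ℓ 0ℓ
≋-setoid {A} e = record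
  { Carrier       = Lin A
  ; _≈_           = _≋[ e ]_
  ; isEquivalence = record { refl = ≋-refl ; sym = ≋-sym ; trans = ≋-trans }
  }

module _ {A : Set} (e : DecidableEquality A) {P : A → Set} where

  InSpan-resp : {p q : Lin A} → p ≋[ e ] q → InSpan e P p → InSpan e P q
  InSpan-resp (mk≋ p≈q) p∈P b q[b]≢0 = p∈P b (λ p[b]≡0 → q[b]≢0 (trans (sym (p≈q b)) p[b]≡0))

  InSpan-[] : InSpan e P []
  InSpan-[] b 0≢0 = ⊥-elim (0≢0 refl)

  InSpan-pure : {a : A} → P a → InSpan e P (pure a)
  InSpan-pure {a} Pa b nz with e a b
  ... | yes refl = Pa
  ... | no  _    = ⊥-elim (nz refl)

  InSpan-++ : {p q : Lin A} → InSpan e P p → InSpan e P q → InSpan e P (p ++ q)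
  InSpan-++ {p} {q} p∈P q∈P b nz with coeff e p b ℚ.≟ 0ℚ
  ... | no  p[b]≢0 = p∈P b p[b]≢0
  ... | yes p[b]≡0 = q∈P b (λ q[b]≡0 → nz (trans (coeff-++ e p q b) (cong₂ _+_ p[b]≡0 q[b]≡0)))

  InSpan-scale : ∀ c {p : Lin A} → InSpan e P p → InSpan e P (scale c p)
  InSpan-scale c {p} p∈P b nz =
    p∈P b (λ p[b]≡0 → nz (trans (coeff-scale e c p b) (trans (cong (c *_) p[b]≡0) (ℚP.*-zeroʳ c))))

  InSpan-neg : {p : Lin A} → InSpan e P p → InSpan e P (neg p)
  InSpan-neg {p} = InSpan-scale (- 1ℚ) {p}

  extℚ-cong-InSpan : (g h : A → ℚ) (p : Lin A) → InSpan e P p → (∀ a → P a → g a ≡ h a) → extℚ g p ≡ extℚ h p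
  extℚ-cong-InSpan g h p p∈P g≡h = ℚ+.x∙y⁻¹≈ε⇒x≈y _ _ (begin
      extℚ g p - extℚ h p             ≡⟨ cong (extℚ g p +_) (sym (extℚ-neg h p)) ⟩
      extℚ g p + extℚ (λ a → - h a) p ≡⟨ sym (extℚ-+ g _ p) ⟩
      extℚ (λ a → g a - h a) p        ≡⟨ extℚ-vanishes e _ p g-h≡0 ⟩
      0ℚ                              ∎)
    where
    open ≡-Reasoning
    g-h≡0 : ∀ a → coeff e p a ≡ 0ℚ ⊎ g a - h a ≡ 0ℚ
    g-h≡0 a with coeff e p a ℚ.≟ 0ℚ
    ... | yes p[a]≡0 = inj₁ p[a]≡0
    ... | no  p[a]≢0 = inj₂ (trans (cong (_- h a) (g≡h a (p∈P a p[a]≢0))) (ℚP.+-inverseʳ (h a)))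

InSpan-⊤ : {A : Set} (e : DecidableEquality A) (p : Lin A) → InSpan e (λ _ → ⊤) p
InSpan-⊤ e p _ _ = tt

ext-pure-id : {A : Set} {e : DecidableEquality A} (p : Lin A) → ext pure p ≋[ e ] p
ext-pure-id {e = e} p = mk≋ (go p)
  where
  go : ∀ p → Eq e (ext pure p) p
  go []            b = refl
  go ((c , a) ∷ p) b with e a b
  ... | yes _ = cong₂ _+_ (ℚP.*-identityʳ c) (go p b)
  ... | no  _ = go p b

module _ {A B : Set} {eB : DecidableEquality B} where

  coeff-ext : (f : A → Lin B) (p : Lin A) (b : B) → coeff eB (ext f p) b ≡ extℚ (λ a → coeff eB (f a) b) p
  coeff-ext f []            b = refl
  coeff-ext f ((c , a) ∷ p) b = trans (coeff-++ eB (scale c (f a)) (ext f p) b)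
    (cong₂ _+_ (coeff-scale eB c (f a) b) (coeff-ext f p b))

  ext-resp : {eA : DecidableEquality A} (f : A → Lin B) {p q : Lin A} → p ≋[ eA ] q → ext f p ≋[ eB ] ext f q
  ext-resp f {p} {q} p≋q = mk≋ λ b →
    trans (coeff-ext f p b) (trans (extℚ-cong-≋ (λ a → coeff eB (f a) b) p≋q) (sym (coeff-ext f q b)))

  ext-cong : {f g : A → Lin B} → (∀ a → f a ≋[ eB ] g a) → (p : Lin A) → ext f p ≋[ eB ] ext g p
  ext-cong {f} {g} f≋g p = mk≋ λ b →
    trans (coeff-ext f p b) (trans (extℚ-cong (λ a → coeff-≡ (f≋g a) b) p) (sym (coeff-ext g p b)))

  ext-cong-InSpan : (eA : DecidableEquality A) {P : A → Set} {f g : A → Lin B} (p : Lin A) →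
    InSpan eA P p → (∀ a → P a → f a ≋[ eB ] g a) → ext f p ≋[ eB ] ext g p
  ext-cong-InSpan eA {f = f} {g} p p∈P f≋g = mk≋ λ b →
    trans (coeff-ext f p b)
      (trans (extℚ-cong-InSpan eA _ _ p p∈P (λ a Pa → coeff-≡ (f≋g a Pa) b)) (sym (coeff-ext g p b)))

  ext-pure : (f : A → Lin B) (a : A) → ext f (pure a) ≋[ eB ] f a
  ext-pure f a = mk≋ λ b → trans (coeff-ext f (pure a) b) (extℚ-pure (λ a → coeff eB (f a) b) a)

  ext-scale : (f : A → Lin B) (c : ℚ) (p : Lin A) → ext f (scale c p) ≋[ eB ] scale c (ext f p)
  ext-scale f c p = mk≋ λ b →
    trans (coeff-ext f (scale c p) b)
      (trans (extℚ-scale _ c p) (trans (cong (c *_) (sym (coeff-ext f p b))) (sym (coeff-scale eB c (ext f p) b))))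

InSpan-ext : {A B : Set} (eA : DecidableEquality A) (eB : DecidableEquality B) {Q : A → Set} {P : B → Set} →
  (∀ b → Dec (P b)) → {f : A → Lin B} {p : Lin A} →
  InSpan eA Q p → (∀ a → Q a → InSpan eB P (f a)) → InSpan eB P (ext f p)
InSpan-ext eA eB P? {f} {p} p∈Q f∈P b nz with P? b
... | yes Pb = Pb
... | no ¬Pb = ⊥-elim (nz (trans (coeff-ext f p b) (extℚ-vanishes eA _ p f[a][b]≡0)))
  where
  f[a][b]≡0 : ∀ a → coeff eA p a ≡ 0ℚ ⊎ coeff eB (f a) b ≡ 0ℚ
  f[a][b]≡0 a with coeff eA p a ℚ.≟ 0ℚ
  ... | yes p[a]≡0 = inj₁ p[a]≡0
  ... | no  p[a]≢0 with coeff eB (f a) b ℚ.≟ 0ℚ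
  ...   | yes z = inj₂ z
  ...   | no  f[a][b]≢0 = ⊥-elim (¬Pb (f∈P a (p∈Q a p[a]≢0) b f[a][b]≢0))

module _ {A B C : Set} {eC : DecidableEquality C} where

  ext-ext : (f : B → Lin C) (g : A → Lin B) (p : Lin A) → ext f (ext g p) ≋[ eC ] ext (λ a → ext f (g a)) p
  ext-ext f g p = mk≋ λ c →
    trans (coeff-ext f (ext g p) c) (trans (extℚ-ext _ g p)
      (trans (extℚ-cong (λ a → sym (coeff-ext f (g a) c)) p) (sym (coeff-ext _ p c))))

  ext-comm : (k : A → B → Lin C) (p : Lin A) (q : Lin B) →
    ext (λ a → ext (k a) q) p ≋[ eC ] ext (λ b → ext (λ a → k a b) p) q
  ext-comm k p q = mk≋ λ c →
    trans (coeff-ext _ p c) (trans (extℚ-cong (λ a → coeff-ext _ q c) p)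
      (trans (extℚ-comm _ p q) (trans (extℚ-cong (λ b → sym (coeff-ext _ p c)) q) (sym (coeff-ext _ q c)))))

module _ {A B C : Set} {eC : DecidableEquality C} (f : A → B → C) where

  bilin-respˡ : {eA : DecidableEquality A} {p p′ : Lin A} (q : Lin B) →
    p ≋[ eA ] p′ → bilin f p q ≋[ eC ] bilin f p′ q
  bilin-respˡ q = ext-resp (λ a → ext (λ b → pure (f a b)) q)

  bilin-respʳ : {eB : DecidableEquality B} (p : Lin A) {q q′ : Lin B} →
    q ≋[ eB ] q′ → bilin f p q ≋[ eC ] bilin f p q′
  bilin-respʳ p q≋q′ = ext-cong (λ a → ext-resp (λ b → pure (f a b)) q≋q′) p

  bilin-resp : {eA : DecidableEquality A} {eB : DecidableEquality B} {p p′ : Lin A} {q q′ : Lin B} →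
    p ≋[ eA ] p′ → q ≋[ eB ] q′ → bilin f p q ≋[ eC ] bilin f p′ q′
  bilin-resp {p′ = p′} {q} p≋p′ q≋q′ = ≋-trans (bilin-respˡ q p≋p′) (bilin-respʳ p′ q≋q′)

  bilin-extˡ : {D : Set} (g : D → Lin A) (p : Lin D) (q : Lin B) →
    bilin f (ext g p) q ≋[ eC ] ext (λ d → bilin f (g d) q) p
  bilin-extˡ g p q = ext-ext _ g p

  bilin-extʳ : {D : Set} (g : D → Lin B) (p : Lin A) (q : Lin D) →
    bilin f p (ext g q) ≋[ eC ] ext (λ d → bilin f p (g d)) q
  bilin-extʳ g p q = ≋-trans (ext-cong (λ a → ext-ext (λ b → pure (f a b)) g q) p)
                             (ext-comm (λ a d → ext (λ b → pure (f a b)) (g d)) p q)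

  bilin-pureˡ : (a : A) (q : Lin B) → bilin f (pure a) q ≋[ eC ] ext (λ b → pure (f a b)) q
  bilin-pureˡ a q = ext-pure (λ a → ext (λ b → pure (f a b)) q) a

  bilin-pureʳ : (p : Lin A) (b : B) → bilin f p (pure b) ≋[ eC ] ext (λ a → pure (f a b)) p
  bilin-pureʳ p b = ext-cong (λ a → ext-pure (λ b → pure (f a b)) b) p

  bilin-pure : (a : A) (b : B) → bilin f (pure a) (pure b) ≋[ eC ] pure (f a b)
  bilin-pure a b = ≋-trans (bilin-pureˡ a (pure b)) (ext-pure (λ b → pure (f a b)) b)

ext-bilin : {A B C D : Set} {eD : DecidableEquality D} (f : A → B → C) (g : C → Lin D) (p : Lin A) (q : Lin B) →
  ext g (bilin f p q) ≋[ eD ] ext (λ a → ext (λ b → g (f a b)) q) p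
ext-bilin f g p q = ≋-trans (ext-ext g _ p)
  (ext-cong (λ a → ≋-trans (ext-ext g (λ b → pure (f a b)) q) (ext-cong (λ b → ext-pure g (f a b)) q)) p)

InSpan-bilin : {A B C : Set} (eA : DecidableEquality A) (eB : DecidableEquality B) (eC : DecidableEquality C)
  (f : A → B → C) {Q : A → Set} {R : B → Set} {P : C → Set} → (∀ c → Dec (P c)) → {p : Lin A} {q : Lin B} →
  InSpan eA Q p → InSpan eB R q → (∀ a b → Q a → R b → P (f a b)) → InSpan eC P (bilin f p q)
InSpan-bilin eA eB eC f P? {p} {q} p∈Q q∈R QR⇒P =
  InSpan-ext eA eC P? {p = p} p∈Q λ a Qa →
    InSpan-ext eB eC P? {p = q} q∈R λ b Rb → InSpan-pure eC (QR⇒P a b Qa Rb)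

-- The algebra 𝔥

infix 4 _≋H_
_≋H_ : H → H → Set
p ≋H q = p ≋[ _≟W_ ] q

module ≋H-Reasoning = SetoidReasoning (≋-setoid _≟W_)

·-resp : {p p′ q q′ : H} → p ≋H p′ → q ≋H q′ → p · q ≋H p′ · q′
·-resp = bilin-resp _++_

·-respʳ : (p : H) {q q′ : H} → q ≋H q′ → p · q ≋H p · q′
·-respʳ p = ·-resp (≋-refl {p = p})

·-respˡ : {p p′ : H} (q : H) → p ≋H p′ → p · q ≋H p′ · q
·-respˡ q p≋p′ = ·-resp p≋p′ (≋-refl {p = q})

pure-· : ∀ u v → pure u · pure v ≋H pure (u ++ v)
pure-· = bilin-pure _++_

·-extˡ : (g : Word → H) (p q : H) → ext g p · q ≋H ext (λ a → g a · q) p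
·-extˡ g = bilin-extˡ _++_ g

·-extʳ : (g : Word → H) (p q : H) → p · ext g q ≋H ext (λ b → p · g b) q
·-extʳ g = bilin-extʳ _++_ g

·-identityˡ : ∀ p → pure [] · p ≋H p
·-identityˡ p = ≋-trans (bilin-pureˡ _++_ [] p) (ext-pure-id p)

·-identityʳ : ∀ p → p · pure [] ≋H p
·-identityʳ p = ≋-trans (bilin-pureʳ _++_ p [])
  (≋-trans (ext-cong (λ a → ≡⇒≋ (cong pure (LP.++-identityʳ a))) p) (ext-pure-id p))

·-assoc : ∀ p q r → (p · q) · r ≋H p · (q · r)
·-assoc p q r = begin
    (p · q) · r
  ≈⟨ bilin-extˡ _++_ _ p r ⟩
    ext (λ a → bilin _++_ (ext (λ b → pure (a ++ b)) q) r) p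
  ≈⟨ ext-cong (λ a → bilin-extˡ _++_ _ q r) p ⟩
    ext (λ a → ext (λ b → pure (a ++ b) · r) q) p
  ≈⟨ ext-cong (λ a → ext-cong (λ b → bilin-pureˡ _++_ (a ++ b) r) q) p ⟩
    ext (λ a → ext (λ b → ext (λ c → pure ((a ++ b) ++ c)) r) q) p
  ≈⟨ ext-cong (λ a → ext-cong (λ b → ext-cong (λ c → ≡⇒≋ (cong pure (LP.++-assoc a b c))) r) q) p ⟩
    ext (λ a → ext (λ b → ext (λ c → pure (a ++ (b ++ c))) r) q) p
  ≈⟨ ext-cong (λ a → ≋-sym (ext-bilin _++_ (λ bc → pure (a ++ bc)) q r)) p ⟩
    p · (q · r) ∎
  where open ≋H-Reasoning

module _ (f : Letter → H) where

  algMap-++ : ∀ u v → algMap f (u ++ v) ≋H algMap f u · algMap f v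
  algMap-++ []      v = ≋-sym (·-identityˡ (algMap f v))
  algMap-++ (a ∷ u) v = ≋-trans (·-respʳ (f a) (algMap-++ u v)) (≋-sym (·-assoc (f a) (algMap f u) (algMap f v)))

  algMap-letter : ∀ l → algMap f (l ∷ []) ≋H f l
  algMap-letter l = ·-identityʳ (f l)

  ext-algMap-letter : ∀ l → ext (algMap f) (pure (l ∷ [])) ≋H f l
  ext-algMap-letter l = ≋-trans (ext-pure (algMap f) (l ∷ [])) (algMap-letter l)

  ext-algMap-· : ∀ p q → ext (algMap f) (p · q) ≋H ext (algMap f) p · ext (algMap f) q
  ext-algMap-· p q = begin
      ext F (p · q)                              ≈⟨ ext-bilin _++_ F p q ⟩
      ext (λ a → ext (λ b → F (a ++ b)) q) p     ≈⟨ ext-cong (λ a → ext-cong (λ b → algMap-++ a b) q) p ⟩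
      ext (λ a → ext (λ b → F a · F b) q) p      ≈⟨ ext-cong (λ a → ≋-sym (·-extʳ F (F a) q)) p ⟩
      ext (λ a → F a · ext F q) p                ≈⟨ ≋-sym (·-extˡ F p (ext F q)) ⟩
      ext F p · ext F q                          ∎
    where
    open ≋H-Reasoning
    F = algMap f

algMap-inverse : (f g : Letter → H) → (∀ l → ext (algMap f) (g l) ≋H pure (l ∷ [])) →
  ∀ w → ext (algMap f) (algMap g w) ≋H pure w
algMap-inverse f g f∘g≋id []      = ext-pure (algMap f) []
algMap-inverse f g f∘g≋id (a ∷ w) = begin
    ext (algMap f) (g a · algMap g w)                    ≈⟨ ext-algMap-· f (g a) (algMap g w) ⟩
    ext (algMap f) (g a) · ext (algMap f) (algMap g w)   ≈⟨ ·-resp (f∘g≋id a) (algMap-inverse f g f∘g≋id w) ⟩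
    pure (a ∷ []) · pure w                               ≈⟨ pure-· (a ∷ []) w ⟩
    pure (a ∷ w)                                         ∎
  where open ≋H-Reasoning

γ-γinv-letter : ∀ l → ext γW (γinvL l) ≋H pure (l ∷ [])
γ-γinv-letter X = ext-algMap-letter γL X
γ-γinv-letter Y = begin
    ext γW (yH ++ neg xH)          ≡⟨ ext-++ γW yH (neg xH) ⟩
    ext γW yH ++ ext γW (neg xH)   ≈⟨ ++-cong (ext-algMap-letter γL Y)
                                              (≋-trans (ext-scale γW (- 1ℚ) xH) (neg-cong (ext-algMap-letter γL X))) ⟩
    (xH ++ yH) ++ neg xH           ≈⟨ ++-neg-cancel xH yH ⟩
    yH                             ∎
  where open ≋H-Reasoning

γinv-γ-letter : ∀ l → ext γinvW (γL l) ≋H pure (l ∷ [])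
γinv-γ-letter X = ext-algMap-letter γinvL X
γinv-γ-letter Y = begin
    ext γinvW (xH ++ yH)             ≡⟨ ext-++ γinvW xH yH ⟩
    ext γinvW xH ++ ext γinvW yH     ≈⟨ ++-cong (ext-algMap-letter γinvL X) (ext-algMap-letter γinvL Y) ⟩
    xH ++ (yH ++ neg xH)             ≡⟨ LP.++-assoc xH yH (neg xH) ⟨
    (xH ++ yH) ++ neg xH             ≈⟨ ++-neg-cancel xH yH ⟩
    yH                               ∎
  where open ≋H-Reasoning

γ-γinv : ∀ w → ext γW (γinvW w) ≋H pure w
γ-γinv = algMap-inverse γL γinvL γ-γinv-letter

γinv-γ : ∀ w → ext γinvW (γW w) ≋H pure w
γinv-γ = algMap-inverse γinvL γL γinv-γ-letter

-- The map d and the subspace 𝔥⁰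

-- d with γ replaced by an arbitrary algebra map; d itself is `dWith γL`, its inverse `dWith γinvL`.
dWith : (Letter → H) → Word → H
dWith f w with L.unsnoc w
... | nothing     = pure []
... | just (u , X) = []
... | just (u , Y) = algMap f u · yH

dW≡dWith-γ : ∀ w → dW w ≡ dWith γL w
dW≡dWith-γ w with L.unsnoc w
... | nothing     = refl
... | just (u , X) = refl
... | just (u , Y) = refl

d≋ext-dWith-γ : ∀ p → d p ≋H ext (dWith γL) p
d≋ext-dWith-γ = ext-cong (λ w → ≡⇒≋ (dW≡dWith-γ w))

initLast-∷ʳ : ∀ (u : Word) l → L.initLast (u L.∷ʳ l) ≡ (u L.∷ʳ′ l)
initLast-∷ʳ []      l = refl
initLast-∷ʳ (a ∷ u) l rewrite initLast-∷ʳ u l = refl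

unsnoc-∷ʳ : ∀ (u : Word) l → L.unsnoc (u L.∷ʳ l) ≡ just (u , l)
unsnoc-∷ʳ u l rewrite initLast-∷ʳ u l = refl

EndsY-++ : ∀ u {w} → EndsY w → EndsY (u ++ w)
EndsY-++ u (w′ , refl) = u ++ w′ , sym (LP.++-assoc u w′ (Y ∷ []))

module _ (f : Letter → H) where

  dWith-∷ʳY : ∀ u → dWith f (u L.∷ʳ Y) ≡ algMap f u · yH
  dWith-∷ʳY u rewrite unsnoc-∷ʳ u Y = refl

  dWith-++ : ∀ u w → EndsY w → dWith f (u ++ w) ≋H algMap f u · dWith f w
  dWith-++ u w (w′ , refl) = begin
      dWith f (u ++ (w′ L.∷ʳ Y))               ≡⟨ cong (dWith f) (sym (LP.++-assoc u w′ (Y ∷ []))) ⟩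
      dWith f ((u ++ w′) L.∷ʳ Y)               ≡⟨ dWith-∷ʳY (u ++ w′) ⟩
      algMap f (u ++ w′) · yH                  ≈⟨ ·-respˡ yH (algMap-++ f u w′) ⟩
      (algMap f u · algMap f w′) · yH          ≈⟨ ·-assoc (algMap f u) (algMap f w′) yH ⟩
      algMap f u · (algMap f w′ · yH)          ≡⟨ cong (algMap f u ·_) (sym (dWith-∷ʳY w′)) ⟩
      algMap f u · dWith f (w′ L.∷ʳ Y)         ∎
    where open ≋H-Reasoning

  ext-dWith-·y : ∀ p → ext (dWith f) (p · yH) ≋H ext (algMap f) p · yH
  ext-dWith-·y p = begin
      ext (dWith f) (p · yH)                         ≈⟨ ext-resp (dWith f) (bilin-pureʳ {eC = _≟W_} _++_ p (Y ∷ [])) ⟩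
      ext (dWith f) (ext (λ a → pure (a L.∷ʳ Y)) p)  ≈⟨ ext-ext (dWith f) _ p ⟩
      ext (λ a → ext (dWith f) (pure (a L.∷ʳ Y))) p  ≈⟨ ext-cong dWith-pure p ⟩
      ext (λ a → algMap f a · yH) p                  ≈⟨ ≋-sym (·-extˡ (algMap f) p yH) ⟩
      ext (algMap f) p · yH                          ∎
    where
    open ≋H-Reasoning
    dWith-pure : ∀ a → ext (dWith f) (pure (a L.∷ʳ Y)) ≋H algMap f a · yH
    dWith-pure a = ≋-trans (ext-pure (dWith f) (a L.∷ʳ Y)) (≡⇒≋ (dWith-∷ʳY a))

dWith-inverse : (f g : Letter → H) → (∀ w → ext (algMap f) (algMap g w) ≋H pure w) →
  ∀ w → w ≡ [] ⊎ EndsY w → ext (dWith f) (dWith g w) ≋H pure w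
dWith-inverse f g f∘g≋id .[]          (inj₁ refl)      = ext-pure (dWith f) []
dWith-inverse f g f∘g≋id .(u L.∷ʳ Y) (inj₂ (u , refl)) = begin
    ext (dWith f) (dWith g (u L.∷ʳ Y))    ≡⟨ cong (ext (dWith f)) (dWith-∷ʳY g u) ⟩
    ext (dWith f) (algMap g u · yH)       ≈⟨ ext-dWith-·y f (algMap g u) ⟩
    ext (algMap f) (algMap g u) · yH      ≈⟨ ·-respˡ yH (f∘g≋id u) ⟩
    pure u · yH                           ≈⟨ pure-· u (Y ∷ []) ⟩
    pure (u L.∷ʳ Y)                       ∎
  where open ≋H-Reasoning

StartsX? : ∀ w → Dec (StartsX w)
StartsX? []      = no λ ()
StartsX? (X ∷ w) = yes (w , refl)
StartsX? (Y ∷ w) = no λ ()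

EndsY? : ∀ w → Dec (EndsY w)
EndsY? w with L.initLast w
... | []      = no λ { ([] , ()) ; (_ ∷ _ , ()) }
... | u ∷ʳ′ Y = yes (u , refl)
... | u ∷ʳ′ X = no λ { (u′ , eq) → X≢Y (LP.∷ʳ-injectiveʳ u u′ eq) }
  where
  X≢Y : ¬ X ≡ Y
  X≢Y ()

StartsXEndsY : Word → Set
StartsXEndsY w = StartsX w × EndsY w

StartsXEndsY? : ∀ w → Dec (StartsXEndsY w)
StartsXEndsY? w = StartsX? w ×-dec EndsY? w

𝔥⁰-word : Word → Set
𝔥⁰-word w = (w ≡ []) ⊎ StartsXEndsY w

𝔥⁰-word? : ∀ w → Dec (𝔥⁰-word w)
𝔥⁰-word? w = (w ≟W []) ⊎-dec StartsXEndsY? w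

𝔥⁰-word⇒EndsY : ∀ {w} → 𝔥⁰-word w → w ≡ [] ⊎ EndsY w
𝔥⁰-word⇒EndsY (inj₁ w≡[])     = inj₁ w≡[]
𝔥⁰-word⇒EndsY (inj₂ (_ , ey)) = inj₂ ey

InSpan-x· : ∀ q → InSpan _≟W_ StartsX (xH · q)
InSpan-x· q = InSpan-bilin _≟W_ _≟W_ _≟W_ _++_ StartsX? {xH} {q}
  (InSpan-pure _≟W_ {λ a → a ≡ X ∷ []} refl) (InSpan-⊤ _≟W_ q) λ { ._ b refl _ → b , refl }

InSpan-·y : ∀ q → InSpan _≟W_ EndsY (q · yH)
InSpan-·y q = InSpan-bilin _≟W_ _≟W_ _≟W_ _++_ EndsY? {q} {yH}
  (InSpan-⊤ _≟W_ q) (InSpan-pure _≟W_ {λ b → b ≡ Y ∷ []} refl) λ { a ._ _ refl → a , refl }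

InSpan-x·y : ∀ q → InSpan _≟W_ StartsXEndsY ((xH · q) · yH)
InSpan-x·y q = InSpan-bilin _≟W_ _≟W_ _≟W_ _++_ StartsXEndsY? {xH · q} {yH}
  (InSpan-x· q) (InSpan-pure _≟W_ {λ b → b ≡ Y ∷ []} refl)
  λ { ._ ._ (u , refl) refl → (u L.∷ʳ Y , refl) , (X ∷ u , refl) }

dWith-𝔥⁰ : (f : Letter → H) → f X ≡ xH → ∀ w → 𝔥⁰-word w → InSpan _≟W_ 𝔥⁰-word (dWith f w)
dWith-𝔥⁰ f fX≡x .[] (inj₁ refl) = InSpan-pure _≟W_ (inj₁ refl)
dWith-𝔥⁰ f fX≡x ._  (inj₂ ((_ , refl) , ([] , ())))
dWith-𝔥⁰ f fX≡x ._  (inj₂ ((_ , refl) , (Y ∷ _ , ())))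
dWith-𝔥⁰ f fX≡x ._  (inj₂ ((_ , refl) , (X ∷ u , refl)))
  rewrite dWith-∷ʳY f (X ∷ u) | fX≡x = λ b nz → inj₂ (InSpan-x·y (algMap f u) b nz)

ext-dWith-𝔥⁰ : (f : Letter → H) → f X ≡ xH → ∀ p → InH0 p → InH0 (ext (dWith f) p)
ext-dWith-𝔥⁰ f fX≡x p p∈𝔥⁰ = InSpan-ext _≟W_ _≟W_ 𝔥⁰-word? {p = p} p∈𝔥⁰ (dWith-𝔥⁰ f fX≡x)

ext-dWith-inverse : (f g : Letter → H) → (∀ w → ext (algMap f) (algMap g w) ≋H pure w) →
  ∀ p → InH0 p → ext (dWith f) (ext (dWith g) p) ≋H p
ext-dWith-inverse f g f∘g≋id p p∈𝔥⁰ = begin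
    ext (dWith f) (ext (dWith g) p)          ≈⟨ ext-ext (dWith f) (dWith g) p ⟩
    ext (λ w → ext (dWith f) (dWith g w)) p  ≈⟨ ext-cong-InSpan _≟W_ p p∈𝔥⁰ (λ w → dWith-inverse f g f∘g≋id w ∘ 𝔥⁰-word⇒EndsY) ⟩
    ext pure p                               ≈⟨ ext-pure-id p ⟩
    p                                        ∎
  where open ≋H-Reasoning

d⁻¹ : H → H
d⁻¹ = ext (dWith γinvL)

d-𝔥⁰ : ∀ p → InH0 p → InH0 (d p)
d-𝔥⁰ p p∈𝔥⁰ = InSpan-resp _≟W_ (≋-sym (d≋ext-dWith-γ p)) (ext-dWith-𝔥⁰ γL refl p p∈𝔥⁰)

d⁻¹-d : ∀ p → InH0 p → d⁻¹ (d p) ≋H p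
d⁻¹-d p p∈𝔥⁰ = ≋-trans (ext-resp (dWith γinvL) (d≋ext-dWith-γ p)) (ext-dWith-inverse γinvL γL γinv-γ p p∈𝔥⁰)

d-d⁻¹ : ∀ p → InH0 p → d (d⁻¹ p) ≋H p
d-d⁻¹ p p∈𝔥⁰ = ≋-trans (d≋ext-dWith-γ (d⁻¹ p)) (ext-dWith-inverse γL γinvL γ-γinv p p∈𝔥⁰)

d-injective-𝔥⁰ : ∀ p q → InH0 p → InH0 q → d p ≈H d q → p ≈H q
d-injective-𝔥⁰ p q p∈𝔥⁰ q∈𝔥⁰ dp≈dq =
  coeff-≡ (begin
    p          ≈⟨ d⁻¹-d p p∈𝔥⁰ ⟨
    d⁻¹ (d p)  ≈⟨ ext-resp (dWith γinvL) {d p} {d q} (mk≋ dp≈dq) ⟩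
    d⁻¹ (d q)  ≈⟨ d⁻¹-d q q∈𝔥⁰ ⟩
    q          ∎)
  where open ≋H-Reasoning

d-surjective-𝔥⁰ : ∀ q → InH0 q → ∃ λ p → InH0 p × d p ≈H q
d-surjective-𝔥⁰ q q∈𝔥⁰ = d⁻¹ q , ext-dWith-𝔥⁰ γinvL refl q q∈𝔥⁰ , coeff-≡ (d-d⁻¹ q q∈𝔥⁰)

-- Tensor products

_≟V_ : ∀ {m} → DecidableEquality (Vec Word m)
_≟V_ = VP.≡-dec _≟W_

tensorV-resp : ∀ {m} {ps qs : Vec H m} → Pointwise _≋H_ ps qs → tensorV ps ≋[ _≟V_ ] tensorV qs
tensorV-resp []            = ≋-refl
tensorV-resp (p≋q ∷ ps≋qs) = bilin-resp _∷_ p≋q (tensorV-resp ps≋qs)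

tensorV-pure : ∀ {m} (v : Vec Word m) → tensorV (V.map pure v) ≋[ _≟V_ ] pure v
tensorV-pure []      = ≋-refl
tensorV-pure (a ∷ v) = ≋-trans (bilin-respʳ _∷_ (pure a) (tensorV-pure v)) (bilin-pure _∷_ a v)

prodV : ∀ {m} → Vec H m → H
prodV []       = pure []
prodV (p ∷ ps) = p · prodV ps

cat : ∀ {m} → Vec Word m → Word
cat v = L.concat (V.toList v)

ext-tensorV-map : ∀ {m} (G : Word → H) (ps : Vec H m) →
  ext (λ v → tensorV (V.map G v)) (tensorV ps) ≋[ _≟V_ ] tensorV (V.map (ext G) ps)
ext-tensorV-map G []       = ext-pure (λ v → tensorV (V.map G v)) []
ext-tensorV-map G (p ∷ ps) = begin
    ext TG (bilin _∷_ p (tensorV ps))                     ≈⟨ ext-bilin _∷_ TG p (tensorV ps) ⟩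
    ext (λ a → ext (λ v → bilin _∷_ (G a) (TG v)) (tensorV ps)) p
                                                          ≈⟨ ext-cong (λ a → ≋-sym (bilin-extʳ _∷_ TG (G a) (tensorV ps))) p ⟩
    ext (λ a → bilin _∷_ (G a) (ext TG (tensorV ps))) p   ≈⟨ ≋-sym (bilin-extˡ _∷_ G p (ext TG (tensorV ps))) ⟩
    bilin _∷_ (ext G p) (ext TG (tensorV ps))             ≈⟨ bilin-respʳ _∷_ (ext G p) (ext-tensorV-map G ps) ⟩
    bilin _∷_ (ext G p) (tensorV (V.map (ext G) ps))      ∎
  where
  open SetoidReasoning (≋-setoid _≟V_)
  TG : ∀ {k} → Vec Word k → Lin (Vec Word k)
  TG v = tensorV (V.map G v)

ext-cat-tensorV : ∀ {m} (ps : Vec H m) → ext (λ v → pure (cat v)) (tensorV ps) ≋H prodV ps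
ext-cat-tensorV []       = ext-pure (λ v → pure (cat v)) []
ext-cat-tensorV (p ∷ ps) = begin
    ext (λ v → pure (cat v)) (bilin _∷_ p V)        ≈⟨ ext-bilin _∷_ (λ v → pure (cat v)) p V ⟩
    ext (λ a → ext (λ v → pure (a ++ cat v)) V) p   ≈⟨ ext-comm (λ a v → pure (a ++ cat v)) p V ⟩
    ext (λ v → ext (λ a → pure (a ++ cat v)) p) V   ≈⟨ ext-cong (λ v → ≋-sym (bilin-pureʳ _++_ p (cat v))) V ⟩
    ext (λ v → p · pure (cat v)) V                  ≈⟨ ≋-sym (bilin-extʳ _++_ (λ v → pure (cat v)) p V) ⟩
    p · ext (λ v → pure (cat v)) V                  ≈⟨ ·-respʳ p (ext-cat-tensorV ps) ⟩
    p · prodV ps                                    ∎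
  where
  open ≋H-Reasoning
  V = tensorV ps

algMap-cat : ∀ (f : Letter → H) {m} (v : Vec Word m) → algMap f (cat v) ≋H prodV (V.map (algMap f) v)
algMap-cat f []      = ≋-refl
algMap-cat f (a ∷ v) = ≋-trans (algMap-++ f a (cat v)) (·-respʳ (algMap f a) (algMap-cat f v))

infix 4 _≋T_
_≋T_ : ∀ {n} → T n → T n → Set
s ≋T t = s ≋[ _≟B_ ] t

module ≋T-Reasoning (n : ℕ) = SetoidReasoning (≋-setoid (_≟B_ {n}))

_≟R_ : ∀ {n} → DecidableEquality (Vec Word n × Word)
_≟R_ = PP.≡-dec _≟V_ _≟W_

module _ {n : ℕ} where

  tensor-resp : {p p′ r r′ : H} {ps ps′ : Vec H n} →
    p ≋H p′ → Pointwise _≋H_ ps ps′ → r ≋H r′ → tensor p ps r ≋T tensor p′ ps′ r′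
  tensor-resp p≋p′ ps≋ps′ r≋r′ = bilin-resp _,_ p≋p′ (bilin-resp {eC = _≟R_} _,_ (tensorV-resp ps≋ps′) r≋r′)

  tensor-respˡ : {p p′ : H} (ps : Vec H n) (r : H) → p ≋H p′ → tensor p ps r ≋T tensor p′ ps r
  tensor-respˡ ps r p≋p′ = tensor-resp {ps = ps} p≋p′ (Pointwise.refl ≋-refl) (≋-refl {p = r})

  tensor-respʳ : (p : H) (ps : Vec H n) {r r′ : H} → r ≋H r′ → tensor p ps r ≋T tensor p ps r′
  tensor-respʳ p ps r≋r′ = tensor-resp {ps = ps} (≋-refl {p = p}) (Pointwise.refl ≋-refl) r≋r′

  tensor-pure : ∀ a (v : Vec Word n) c → tensor (pure a) (V.map pure v) (pure c) ≋T pure (a , v , c)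
  tensor-pure a v c = ≋-trans
    (bilin-respʳ _,_ (pure a) (≋-trans (bilin-respˡ {eC = _≟R_} _,_ (pure c) (tensorV-pure v)) (bilin-pure _,_ v c)))
    (bilin-pure _,_ a (v , c))

  ext-tensor : {B : Set} {eB : DecidableEquality B} (g : Basis n → Lin B) (p : H) (ps : Vec H n) (r : H) →
    ext g (tensor p ps r) ≋[ eB ] ext (λ a → ext (λ v → ext (λ c → g (a , v , c)) r) (tensorV ps)) p
  ext-tensor g p ps r = ≋-trans (ext-bilin _,_ g p (bilin _,_ (tensorV ps) r))
    (ext-cong (λ a → ext-bilin _,_ (λ vc → g (a , vc)) (tensorV ps) r) p)

  tensor-extˡ : (h : Word → H) (p : H) (ps : Vec H n) (r : H) → tensor (ext h p) ps r ≋T ext (λ a → tensor (h a) ps r) p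
  tensor-extˡ h p ps r = bilin-extˡ _,_ h p (bilin _,_ (tensorV ps) r)

  tensor-extʳ : (h : Word → H) (p : H) (ps : Vec H n) (r : H) → tensor p ps (ext h r) ≋T ext (λ c → tensor p ps (h c)) r
  tensor-extʳ h p ps r = ≋-trans (bilin-respʳ _,_ p (bilin-extʳ {eC = _≟R_} _,_ h (tensorV ps) r))
    (bilin-extʳ _,_ (λ c → bilin _,_ (tensorV ps) (h c)) p r)

  tensor-ext-map : (G : Word → H) (p : H) (ps : Vec H n) (r : H) →
    tensor p (V.map (ext G) ps) r ≋T ext (λ v → tensor p (V.map G v) r) (tensorV ps)
  tensor-ext-map G p ps r = begin
      tensor p (V.map (ext G) ps) r
    ≈⟨ bilin-respʳ _,_ p (bilin-respˡ {eC = _≟R_} _,_ r (≋-sym (ext-tensorV-map G ps))) ⟩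
      bilin _,_ p (bilin _,_ (ext (λ v → tensorV (V.map G v)) (tensorV ps)) r)
    ≈⟨ bilin-respʳ _,_ p (bilin-extˡ {eC = _≟R_} _,_ (λ v → tensorV (V.map G v)) (tensorV ps) r) ⟩
      bilin _,_ p (ext (λ v → bilin _,_ (tensorV (V.map G v)) r) (tensorV ps))
    ≈⟨ bilin-extʳ _,_ (λ v → bilin _,_ (tensorV (V.map G v)) r) p (tensorV ps) ⟩
      ext (λ v → tensor p (V.map G v) r) (tensorV ps) ∎
    where open ≋T-Reasoning n

  ⊗-map : (F₁ G F₂ : Word → H) → Basis n → T n
  ⊗-map F₁ G F₂ (a , v , c) = tensor (F₁ a) (V.map G v) (F₂ c)

  ext-⊗-map-tensor : (F₁ G F₂ : Word → H) (p : H) (ps : Vec H n) (r : H) →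
    ext (⊗-map F₁ G F₂) (tensor p ps r) ≋T tensor (ext F₁ p) (V.map (ext G) ps) (ext F₂ r)
  ext-⊗-map-tensor F₁ G F₂ p ps r = begin
      ext (⊗-map F₁ G F₂) (tensor p ps r)
    ≈⟨ ext-tensor _ p ps r ⟩
      ext (λ a → ext (λ v → ext (λ c → tensor (F₁ a) (V.map G v) (F₂ c)) r) (tensorV ps)) p
    ≈⟨ ext-cong (λ a → ext-comm (λ v c → tensor (F₁ a) (V.map G v) (F₂ c)) (tensorV ps) r) p ⟩
      ext (λ a → ext (λ c → ext (λ v → tensor (F₁ a) (V.map G v) (F₂ c)) (tensorV ps)) r) p
    ≈⟨ ext-cong (λ a → ext-cong (λ c → ≋-sym (tensor-ext-map G (F₁ a) ps (F₂ c))) r) p ⟩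
      ext (λ a → ext (λ c → tensor (F₁ a) (V.map (ext G) ps) (F₂ c)) r) p
    ≈⟨ ext-cong (λ a → ≋-sym (tensor-extʳ F₂ (F₁ a) (V.map (ext G) ps) r)) p ⟩
      ext (λ a → tensor (F₁ a) (V.map (ext G) ps) (ext F₂ r)) p
    ≈⟨ ≋-sym (tensor-extˡ F₁ p (V.map (ext G) ps) (ext F₂ r)) ⟩
      tensor (ext F₁ p) (V.map (ext G) ps) (ext F₂ r) ∎
    where open ≋T-Reasoning n

  ⋄ʳ-basis : Basis n → Word → Basis n
  ⋄ʳ-basis (a , v , c) u = (a ++ u , v , c)

  ⋄ˡ-basis : Word → Basis n → Basis n
  ⋄ˡ-basis u (a , v , c) = (a , v , u ++ c)

  tensor-·ˡ : (p q : H) (ps : Vec H n) (r : H) → tensor (p · q) ps r ≋T tensor p ps r ⋄ʳ q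
  tensor-·ˡ p q ps r = begin
      tensor (p · q) ps r
    ≈⟨ tensor-extˡ (λ a → ext (λ u → pure (a ++ u)) q) p ps r ⟩
      ext (λ a → tensor (ext (λ u → pure (a ++ u)) q) ps r) p
    ≈⟨ ext-cong (λ a → tensor-extˡ (λ u → pure (a ++ u)) q ps r) p ⟩
      ext (λ a → ext (λ u → tensor (pure (a ++ u)) ps r) q) p
    ≈⟨ ext-cong (λ a → ext-cong (λ u → bilin-pureˡ _,_ (a ++ u) vr) q) p ⟩
      ext (λ a → ext (λ u → ext (λ R → pure (a ++ u , R)) vr) q) p
    ≈⟨ ext-cong (λ a → ext-comm (λ u R → pure (a ++ u , R)) q vr) p ⟩
      ext (λ a → ext (λ R → ext (λ u → pure (⋄ʳ-basis (a , R) u)) q) vr) p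
    ≈⟨ ext-cong (λ a → ext-cong (λ R → ≋-sym (bilin-pureˡ ⋄ʳ-basis (a , R) q)) vr) p ⟩
      ext (λ a → ext (λ R → bilin ⋄ʳ-basis (pure (a , R)) q) vr) p
    ≈⟨ ext-cong (λ a → ≋-sym (bilin-extˡ ⋄ʳ-basis (λ R → pure (a , R)) vr q)) p ⟩
      ext (λ a → bilin ⋄ʳ-basis (ext (λ R → pure (a , R)) vr) q) p
    ≈⟨ ≋-sym (bilin-extˡ ⋄ʳ-basis (λ a → ext (λ R → pure (a , R)) vr) p q) ⟩
      tensor p ps r ⋄ʳ q ∎
    where
    open ≋T-Reasoning n
    vr = bilin _,_ (tensorV ps) r

  tensor-·ʳ : (p : H) (ps : Vec H n) (q r : H) → tensor p ps (q · r) ≋T q ⋄ˡ tensor p ps r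
  tensor-·ʳ p ps q r = begin
      tensor p ps (q · r)
    ≈⟨ tensor-extʳ (λ u → ext (λ c → pure (u ++ c)) r) p ps q ⟩
      ext (λ u → tensor p ps (ext (λ c → pure (u ++ c)) r)) q
    ≈⟨ ext-cong (λ u → tensor-extʳ (λ c → pure (u ++ c)) p ps r) q ⟩
      ext (λ u → ext (λ c → tensor p ps (pure (u ++ c))) r) q
    ≈⟨ ext-cong (λ u → ext-cong (λ c → ≋-trans (≋-sym (ext-pure-id _)) (ext-tensor pure p ps (pure (u ++ c)))) r) q ⟩
      ext (λ u → ext (λ c → ext (λ a → ext (λ v → ext (λ c′ → pure (a , v , c′)) (pure (u ++ c))) V) p) r) q
    ≈⟨ ext-cong (λ u → ext-cong (λ c → ext-cong (λ a → ext-cong (λ v → ext-pure (λ c′ → pure (a , v , c′)) (u ++ c)) V) p) r) q ⟩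
      ext (λ u → ext (λ c → ext (λ a → ext (λ v → pure (a , v , u ++ c)) V) p) r) q
    ≈⟨ ext-cong (λ u → ext-comm (λ c a → ext (λ v → pure (a , v , u ++ c)) V) r p) q ⟩
      ext (λ u → ext (λ a → ext (λ c → ext (λ v → pure (a , v , u ++ c)) V) r) p) q
    ≈⟨ ext-cong (λ u → ext-cong (λ a → ext-comm (λ c v → pure (a , v , u ++ c)) r V) p) q ⟩
      ext (λ u → ext (λ a → ext (λ v → ext (λ c → pure (⋄ˡ-basis u (a , v , c))) r) V) p) q
    ≈⟨ ext-cong (λ u → ≋-sym (ext-tensor (λ b → pure (⋄ˡ-basis u b)) p ps r)) q ⟩
      q ⋄ˡ tensor p ps r ∎
    where
    open ≋T-Reasoning n
    V = tensorV ps

  InSub-basis : Basis n → Set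
  InSub-basis (a , v , c) = StartsX a × EndsY c

  InSub-basis? : ∀ b → Dec (InSub-basis b)
  InSub-basis? (a , v , c) = StartsX? a ×-dec EndsY? c

  InSub-tensor : {p r : H} (ps : Vec H n) → InSpan _≟W_ StartsX p → InSpan _≟W_ EndsY r → InSub (tensor p ps r)
  InSub-tensor {p} {r} ps p∈X r∈Y =
    InSpan-bilin _≟W_ _≟R_ _≟B_ _,_ InSub-basis? {p} {bilin _,_ (tensorV ps) r} p∈X
      (InSpan-bilin _≟V_ _≟W_ _≟R_ _,_ {R = EndsY} {P = λ vc → EndsY (proj₂ vc)} (λ vc → EndsY? (proj₂ vc))
         {tensorV ps} {r} (InSpan-⊤ _≟V_ (tensorV ps)) r∈Y λ _ _ _ ey → ey)
      λ _ _ sx ey → sx , ey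

  InSub-⋄ʳ : (t : T n) (q : H) → InSub t → InSub (t ⋄ʳ q)
  InSub-⋄ʳ t q t∈Sub = InSpan-bilin _≟B_ _≟W_ _≟B_ ⋄ʳ-basis InSub-basis? {t} {q} t∈Sub (InSpan-⊤ _≟W_ q)
    λ { (._ , v , c) u ((a , refl) , ey) _ → (a ++ u , refl) , ey }

  InSub-⋄ˡ : (q : H) (t : T n) → InSub t → InSub (q ⋄ˡ t)
  InSub-⋄ˡ q t t∈Sub = InSpan-bilin _≟W_ _≟B_ _≟B_ ⋄ˡ-basis InSub-basis? {q} {t} (InSpan-⊤ _≟W_ q) t∈Sub
    λ { u (a , v , c) _ (sx , ey) → sx , EndsY-++ u ey }

  φWith : (Letter → H) → Basis n → T n
  φWith f = ⊗-map (algMap f) (algMap f) (dWith f)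

  ΦWith : (Letter → H) → T n → T n
  ΦWith f = ext (φWith f)

  Φ≋ΦWith-γ : ∀ t → Φ t ≋T ΦWith γL t
  Φ≋ΦWith-γ = ext-cong λ { (a , v , c) → ≡⇒≋ (cong (tensor (γW a) (V.map γW v)) (dW≡dWith-γ c)) }

  module _ (f : Letter → H) where

    ΦWith-InSub : f X ≡ xH → ∀ t → InSub t → InSub (ΦWith f t)
    ΦWith-InSub fX≡x t t∈Sub = InSpan-ext _≟B_ _≟B_ InSub-basis? {p = t} t∈Sub φ-InSub
      where
      φ-InSub : ∀ b → InSub-basis b → InSub (φWith f b)
      φ-InSub (._ , v , ._) ((a , refl) , (c , refl)) rewrite dWith-∷ʳY f c =
        InSub-tensor {p = f X · algMap f a} {r = algMap f c · yH} (V.map (algMap f) v)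
          (subst (λ fX → InSpan _≟W_ StartsX (fX · algMap f a)) (sym fX≡x) (InSpan-x· (algMap f a)))
          (InSpan-·y (algMap f c))

    ΦWith-⋄ʳ : ∀ t q → ΦWith f (t ⋄ʳ q) ≋T ΦWith f t ⋄ʳ ext (algMap f) q
    ΦWith-⋄ʳ t q = begin
        ext (φWith f) (bilin ⋄ʳ-basis t q)
      ≈⟨ ext-bilin ⋄ʳ-basis (φWith f) t q ⟩
        ext (λ b → ext (λ u → φWith f (⋄ʳ-basis b u)) q) t
      ≈⟨ ext-cong (λ b → ext-cong (λ u → φ-⋄ʳ b u) q) t ⟩
        ext (λ b → ext (λ u → φWith f b ⋄ʳ algMap f u) q) t
      ≈⟨ ext-cong (λ b → ≋-sym (bilin-extʳ ⋄ʳ-basis (algMap f) (φWith f b) q)) t ⟩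
        ext (λ b → φWith f b ⋄ʳ ext (algMap f) q) t
      ≈⟨ ≋-sym (bilin-extˡ ⋄ʳ-basis (φWith f) t (ext (algMap f) q)) ⟩
        ΦWith f t ⋄ʳ ext (algMap f) q ∎
      where
      open ≋T-Reasoning n
      φ-⋄ʳ : ∀ b u → φWith f (⋄ʳ-basis b u) ≋T φWith f b ⋄ʳ algMap f u
      φ-⋄ʳ (a , v , c) u = ≋-trans (tensor-respˡ (V.map (algMap f) v) (dWith f c) (algMap-++ f a u))
                                   (tensor-·ˡ (algMap f a) (algMap f u) (V.map (algMap f) v) (dWith f c))

    ΦWith-⋄ˡ : ∀ t q → InSub t → ΦWith f (q ⋄ˡ t) ≋T ext (algMap f) q ⋄ˡ ΦWith f t
    ΦWith-⋄ˡ t q t∈Sub = begin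
        ext (φWith f) (bilin ⋄ˡ-basis q t)
      ≈⟨ ext-bilin ⋄ˡ-basis (φWith f) q t ⟩
        ext (λ u → ext (λ b → φWith f (⋄ˡ-basis u b)) t) q
      ≈⟨ ext-cong (λ u → ext-cong-InSpan _≟B_ t t∈Sub (φ-⋄ˡ u)) q ⟩
        ext (λ u → ext (λ b → algMap f u ⋄ˡ φWith f b) t) q
      ≈⟨ ext-cong (λ u → ≋-sym (bilin-extʳ ⋄ˡ-basis (φWith f) (algMap f u) t)) q ⟩
        ext (λ u → algMap f u ⋄ˡ ΦWith f t) q
      ≈⟨ ≋-sym (bilin-extˡ ⋄ˡ-basis (algMap f) q (ΦWith f t)) ⟩
        ext (algMap f) q ⋄ˡ ΦWith f t ∎
      where
      open ≋T-Reasoning n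
      φ-⋄ˡ : ∀ u b → InSub-basis b → φWith f (⋄ˡ-basis u b) ≋T algMap f u ⋄ˡ φWith f b
      φ-⋄ˡ u (a , v , c) (_ , ey) = ≋-trans (tensor-respʳ (algMap f a) (V.map (algMap f) v) (dWith-++ f u c ey))
                                            (tensor-·ʳ (algMap f a) (V.map (algMap f) v) (algMap f u) (dWith f c))

  ΦWith-inverse : (f g : Letter → H) → (∀ w → ext (algMap f) (algMap g w) ≋H pure w) →
    ∀ t → InSub t → ΦWith f (ΦWith g t) ≋T t
  ΦWith-inverse f g f∘g≋id t t∈Sub = begin
      ΦWith f (ΦWith g t)                ≈⟨ ext-ext (φWith f) (φWith g) t ⟩
      ext (λ b → ΦWith f (φWith g b)) t  ≈⟨ ext-cong-InSpan _≟B_ t t∈Sub φ-inverse ⟩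
      ext pure t                         ≈⟨ ext-pure-id t ⟩
      t                                  ∎
    where
    open ≋T-Reasoning n
    f∘g≋id⋆ : ∀ {m} (v : Vec Word m) → Pointwise _≋H_ (V.map (ext (algMap f)) (V.map (algMap g) v)) (V.map pure v)
    f∘g≋id⋆ []      = []
    f∘g≋id⋆ (a ∷ v) = f∘g≋id a ∷ f∘g≋id⋆ v
    φ-inverse : ∀ b → InSub-basis b → ΦWith f (φWith g b) ≋T pure b
    φ-inverse (a , v , c) (_ , ey) = begin
        ΦWith f (tensor (algMap g a) (V.map (algMap g) v) (dWith g c))
      ≈⟨ ext-⊗-map-tensor (algMap f) (algMap f) (dWith f) (algMap g a) (V.map (algMap g) v) (dWith g c) ⟩
        tensor (ext (algMap f) (algMap g a)) (V.map (ext (algMap f)) (V.map (algMap g) v)) (ext (dWith f) (dWith g c))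
      ≈⟨ tensor-resp (f∘g≋id a) (f∘g≋id⋆ v) (dWith-inverse f g f∘g≋id c (inj₂ ey)) ⟩
        tensor (pure a) (V.map pure v) (pure c)
      ≈⟨ tensor-pure a v c ⟩
        pure (a , v , c) ∎

  M-tensor : (p : H) (ps : Vec H n) (r : H) → M (tensor p ps r) ≋H p · (prodV ps · r)
  M-tensor p ps r = begin
      M (tensor p ps r)
    ≈⟨ ext-tensor (λ b → pure (MB b)) p ps r ⟩
      ext (λ a → ext (λ v → ext (λ c → pure (a ++ (cat v ++ c))) r) V) p
    ≈⟨ ext-cong (λ a → ext-cong (λ v → ≋-sym (prepend-ext a (λ c → cat v ++ c))) V) p ⟩
      ext (λ a → ext (λ v → ext (λ w → pure (a ++ w)) (ext (λ c → pure (cat v ++ c)) r)) V) p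
    ≈⟨ ext-cong (λ a → ≋-sym (ext-ext (λ w → pure (a ++ w)) (λ v → ext (λ c → pure (cat v ++ c)) r) V)) p ⟩
      p · ext (λ v → ext (λ c → pure (cat v ++ c)) r) V
    ≈⟨ ·-respʳ p (ext-cong (λ v → ≋-sym (bilin-pureˡ _++_ (cat v) r)) V) ⟩
      p · ext (λ v → pure (cat v) · r) V
    ≈⟨ ·-respʳ p (≋-sym (bilin-extˡ _++_ (λ v → pure (cat v)) V r)) ⟩
      p · (ext (λ v → pure (cat v)) V · r)
    ≈⟨ ·-respʳ p (·-respˡ r (ext-cat-tensorV ps)) ⟩
      p · (prodV ps · r) ∎
    where
    open ≋H-Reasoning
    V = tensorV ps
    prepend-ext : ∀ a (k : Word → Word) → ext (λ w → pure (a ++ w)) (ext (λ c → pure (k c)) r) ≋H ext (λ c → pure (a ++ k c)) r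
    prepend-ext a k = ≋-trans (ext-ext (λ w → pure (a ++ w)) (λ c → pure (k c)) r)
                              (ext-cong (λ c → ext-pure (λ w → pure (a ++ w)) (k c)) r)

  ext-dWith-M : (f : Letter → H) → ∀ t → InSub t → ext (dWith f) (M t) ≋H M (ΦWith f t)
  ext-dWith-M f t t∈Sub = begin
      ext (dWith f) (M t)                      ≈⟨ ext-ext (dWith f) (λ b → pure (MB b)) t ⟩
      ext (λ b → ext (dWith f) (pure (MB b))) t ≈⟨ ext-cong-InSpan _≟B_ t t∈Sub dWith-MB ⟩
      ext (λ b → M (φWith f b)) t              ≈⟨ ≋-sym (ext-ext (λ b → pure (MB b)) (φWith f) t) ⟩
      M (ΦWith f t)                            ∎
    where
    open ≋H-Reasoning
    dWith-MB : ∀ b → InSub-basis b → ext (dWith f) (pure (MB b)) ≋H M (φWith f b)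
    dWith-MB (a , v , c) (_ , ey) = begin
        ext (dWith f) (pure (a ++ (cat v ++ c)))              ≈⟨ ext-pure (dWith f) (a ++ (cat v ++ c)) ⟩
        dWith f (a ++ (cat v ++ c))                           ≈⟨ dWith-++ f a (cat v ++ c) (EndsY-++ (cat v) ey) ⟩
        algMap f a · dWith f (cat v ++ c)                     ≈⟨ ·-respʳ (algMap f a) (dWith-++ f (cat v) c ey) ⟩
        algMap f a · (algMap f (cat v) · dWith f c)           ≈⟨ ·-respʳ (algMap f a) (·-respˡ (dWith f c) (algMap-cat f v)) ⟩
        algMap f a · (prodV (V.map (algMap f) v) · dWith f c) ≈⟨ ≋-sym (M-tensor (algMap f a) (V.map (algMap f) v) (dWith f c)) ⟩
        M (φWith f (a , v , c))                               ∎

-- The maps 𝒞_n and 𝒞̄_n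

module _ (n : ℕ) where

  InSub-x⊗y : (ps : Vec H n) → InSub (tensor xH ps yH)
  InSub-x⊗y ps = InSub-tensor {p = xH} {r = yH} ps (InSpan-pure _≟W_ ([] , refl)) (InSpan-pure _≟W_ ([] , refl))

  cLetter-InSub : ∀ l → InSub (cLetter n l)
  cLetter-InSub X = InSub-x⊗y (V.replicate n zH)
  cLetter-InSub Y = InSpan-neg _≟B_ {P = InSub-basis} {p = tensor xH (V.replicate n zH) yH} (InSub-x⊗y (V.replicate n zH))

  cbarLetter-InSub : ∀ l → InSub (cbarLetter n l)
  cbarLetter-InSub X = InSub-x⊗y (V.replicate n yH)
  cbarLetter-InSub Y = InSpan-neg _≟B_ {P = InSub-basis} {p = tensor xH (V.replicate n yH) yH} (InSub-x⊗y (V.replicate n yH))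

  CW-InSub : ∀ w → InSub (CW n w)
  CW-InSub []      = InSpan-[] _≟B_
  CW-InSub (a ∷ w) = InSpan-++ _≟B_ {P = InSub-basis} {p = cLetter n a ⋄ʳ pure w} {q = pure (a ∷ []) ⋄ˡ CW n w}
    (InSub-⋄ʳ (cLetter n a) (pure w) (cLetter-InSub a)) (InSub-⋄ˡ (pure (a ∷ [])) (CW n w) (CW-InSub w))

  CbarW-InSub : ∀ w → InSub (CbarW n w)
  CbarW-InSub []      = InSpan-[] _≟B_
  CbarW-InSub (a ∷ w) = InSpan-++ _≟B_ {P = InSub-basis} {p = cbarLetter n a ⋄ʳ γinvW w} {q = γinvL a ⋄ˡ CbarW n w}
    (InSub-⋄ʳ (cbarLetter n a) (γinvW w) (cbarLetter-InSub a)) (InSub-⋄ˡ (γinvL a) (CbarW n w) (CbarW-InSub w))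

  C-InSub : ∀ p → InSub (C n p)
  C-InSub p = InSpan-ext _≟W_ _≟B_ InSub-basis? {p = p} (InSpan-⊤ _≟W_ p) (λ w _ → CW-InSub w)

  Cbar-InSub : ∀ p → InSub (Cbar n p)
  Cbar-InSub p = InSpan-ext _≟W_ _≟B_ InSub-basis? {p = p} (InSpan-⊤ _≟W_ p) (λ w _ → CbarW-InSub w)

  ΦWith-γ-cbarLetter : ∀ l → ΦWith γL (cbarLetter n l) ≋T cLetter n l
  ΦWith-γ-cbarLetter X = ΦWith-γ-x⊗y⊗y
    where
    γ-y⋆ : ∀ k → Pointwise _≋H_ (V.map γ (V.replicate k yH)) (V.replicate k zH)
    γ-y⋆ zero    = []
    γ-y⋆ (suc k) = ext-algMap-letter γL Y ∷ γ-y⋆ k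
    d-y : ext (dWith γL) yH ≋H yH
    d-y = ≋-trans (ext-pure (dWith γL) (Y ∷ [])) (≋-trans (≡⇒≋ (dWith-∷ʳY γL [])) (·-identityˡ yH))
    ΦWith-γ-x⊗y⊗y : ΦWith γL (tensor xH (V.replicate n yH) yH) ≋T tensor xH (V.replicate n zH) yH
    ΦWith-γ-x⊗y⊗y = ≋-trans (ext-⊗-map-tensor γW γW (dWith γL) xH (V.replicate n yH) yH)
                            (tensor-resp (ext-algMap-letter γL X) (γ-y⋆ n) d-y)
  ΦWith-γ-cbarLetter Y = ≋-trans (ext-scale (φWith γL) (- 1ℚ) (tensor xH (V.replicate n yH) yH))
                                 (neg-cong (ΦWith-γ-cbarLetter X))

  ΦWith-γ-CbarW : ∀ w → ΦWith γL (CbarW n w) ≋T CW n w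
  ΦWith-γ-CbarW []      = ≋-refl
  ΦWith-γ-CbarW (a ∷ w) = begin
      ΦWith γL ((cbarLetter n a ⋄ʳ γinvW w) ++ (γinvL a ⋄ˡ CbarW n w))
    ≡⟨ ext-++ (φWith γL) (cbarLetter n a ⋄ʳ γinvW w) (γinvL a ⋄ˡ CbarW n w) ⟩
      ΦWith γL (cbarLetter n a ⋄ʳ γinvW w) ++ ΦWith γL (γinvL a ⋄ˡ CbarW n w)
    ≈⟨ ++-cong (ΦWith-⋄ʳ γL (cbarLetter n a) (γinvW w)) (ΦWith-⋄ˡ γL (CbarW n w) (γinvL a) (CbarW-InSub w)) ⟩
      (ΦWith γL (cbarLetter n a) ⋄ʳ γ (γinvW w)) ++ (γ (γinvL a) ⋄ˡ ΦWith γL (CbarW n w))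
    ≈⟨ ++-cong (bilin-resp ⋄ʳ-basis (ΦWith-γ-cbarLetter a) (γ-γinv w))
               (bilin-resp ⋄ˡ-basis (γ-γinv-letter a) (ΦWith-γ-CbarW w)) ⟩
      (cLetter n a ⋄ʳ pure w) ++ (pure (a ∷ []) ⋄ˡ CW n w) ∎
    where open ≋T-Reasoning n

  Φ-Cbar : ∀ p → Φ (Cbar n p) ≋T C n p
  Φ-Cbar p = begin
      Φ (Cbar n p)                         ≈⟨ Φ≋ΦWith-γ (Cbar n p) ⟩
      ΦWith γL (ext (CbarW n) p)           ≈⟨ ext-ext (φWith γL) (CbarW n) p ⟩
      ext (λ w → ΦWith γL (CbarW n w)) p   ≈⟨ ext-cong ΦWith-γ-CbarW p ⟩
      C n p                                ∎
    where open ≋T-Reasoning n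

  d-M : ∀ (t : T n) → InSub t → d (M t) ≋H M (Φ t)
  d-M t t∈Sub = begin
      d (M t)                 ≈⟨ d≋ext-dWith-γ (M t) ⟩
      ext (dWith γL) (M t)    ≈⟨ ext-dWith-M γL t t∈Sub ⟩
      M (ΦWith γL t)          ≈⟨ ext-resp (λ b → pure (MB {n} b)) (≋-sym (Φ≋ΦWith-γ t)) ⟩
      M (Φ t)                 ∎
    where open ≋H-Reasoning

  d-ρbar : ∀ p → d (ρbar n p) ≋H ρ n p
  d-ρbar p = ≋-trans (d-M (Cbar n p) (Cbar-InSub p)) (ext-resp (λ b → pure (MB {n} b)) (Φ-Cbar p))

  Φ-InSub : ∀ (t : T n) → InSub t → InSub (Φ t)
  Φ-InSub t t∈Sub = InSpan-resp _≟B_ {P = InSub-basis} (≋-sym (Φ≋ΦWith-γ t)) (ΦWith-InSub γL refl t t∈Sub)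

  Ψ : T n → T n
  Ψ = ΦWith γinvL

  Ψ-Φ : ∀ (t : T n) → InSub t → Ψ (Φ t) ≋T t
  Ψ-Φ t t∈Sub = ≋-trans (ext-resp (φWith γinvL) (Φ≋ΦWith-γ t)) (ΦWith-inverse γinvL γL γinv-γ t t∈Sub)

  Φ-Ψ : ∀ (t : T n) → InSub t → Φ (Ψ t) ≋T t
  Φ-Ψ t t∈Sub = ≋-trans (Φ≋ΦWith-γ (Ψ t)) (ΦWith-inverse γL γinvL γ-γinv t t∈Sub)

  Φ-injective-InSub : ∀ (s t : T n) → InSub s → InSub t → Φ s ≈T Φ t → s ≈T t
  Φ-injective-InSub s t s∈Sub t∈Sub Φs≈Φt =
    coeff-≡ (begin
      s        ≈⟨ Ψ-Φ s s∈Sub ⟨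
      Ψ (Φ s)  ≈⟨ ext-resp (φWith γinvL) {Φ s} {Φ t} (mk≋ Φs≈Φt) ⟩
      Ψ (Φ t)  ≈⟨ Ψ-Φ t t∈Sub ⟩
      t        ∎)
    where open ≋T-Reasoning n

  Φ-surjective-InSub : ∀ (t : T n) → InSub t → ∃ λ (s : T n) → InSub s × Φ s ≈T t
  Φ-surjective-InSub t t∈Sub = Ψ t , ΦWith-InSub γinvL refl t t∈Sub , coeff-≡ (Φ-Ψ t t∈Sub)

-- Partial sums of multiple zeta values

↥[1/n] : ∀ n .{{_ : ℕ.NonZero n}} → ↥ (ℤ.+ 1 ℚ./ n) ≡ ℤ.+ 1
↥[1/n] n = trans (sym (ℤP.*-identityʳ _))
  (trans (cong (λ g → ↥ (ℤ.+ 1 ℚ./ n) ℤ.* ℤ.+ g) (sym (ℕG.gcd-zeroˡ n))) (ℚP.↥-/ (ℤ.+ 1) n))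

↧ₙ[1/n] : ∀ n .{{_ : ℕ.NonZero n}} → ↧ₙ (ℤ.+ 1 ℚ./ n) ≡ n
↧ₙ[1/n] n = ℤP.+-injective (trans (sym (ℤP.*-identityʳ _))
  (trans (cong (λ g → ↧ (ℤ.+ 1 ℚ./ n) ℤ.* ℤ.+ g) (sym (ℕG.gcd-zeroˡ n))) (ℚP.↧-/ (ℤ.+ 1) n)))

*-unfold : ∀ p q → p * q ≡ (↥ p ℤ.* ↥ q) ℚ./ (↧ₙ p ℕ.* ↧ₙ q)
*-unfold (mkℚ _ _ _) (mkℚ _ _ _) = refl

inv^-+ : ∀ m k h → inv^ m k * inv^ m h ≡ inv^ m (k ℕ.+ h)
inv^-+ m k h = trans (*-unfold (inv^ m k) (inv^ m h))
  (ℚP./-cong {{_}} {{ℕP.m^n≢0 (suc m) (k ℕ.+ h)}}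
    (cong₂ ℤ._*_ (↥[1/n] _ {{ℕP.m^n≢0 (suc m) k}}) (↥[1/n] _ {{ℕP.m^n≢0 (suc m) h}}))
    (trans (cong₂ ℕ._*_ (↧ₙ[1/n] _ {{ℕP.m^n≢0 (suc m) k}}) (↧ₙ[1/n] _ {{ℕP.m^n≢0 (suc m) h}}))
           (sym (ℕP.^-distribˡ-+-* (suc m) k h))))

-- A pair (h , t) stands for the nonempty index list h ∷ t.
sumOver : (ℕ × List ℕ → ℚ) → List (ℕ × List ℕ) → ℚ
sumOver g []       = 0ℚ
sumOver g (x ∷ xs) = g x + sumOver g xs

sumOver-cong : ∀ {f g} → (∀ x → f x ≡ g x) → ∀ xs → sumOver f xs ≡ sumOver g xs
sumOver-cong f≡g []       = refl
sumOver-cong f≡g (x ∷ xs) = cong₂ _+_ (f≡g x) (sumOver-cong f≡g xs)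

sumOver-zero : ∀ {f} → (∀ x → f x ≡ 0ℚ) → ∀ xs → sumOver f xs ≡ 0ℚ
sumOver-zero f≡0 []       = refl
sumOver-zero f≡0 (x ∷ xs) rewrite f≡0 x | sumOver-zero f≡0 xs = refl

sumOver-+ : ∀ f g xs → sumOver (λ x → f x + g x) xs ≡ sumOver f xs + sumOver g xs
sumOver-+ f g []       = sym (ℚP.+-identityʳ 0ℚ)
sumOver-+ f g (x ∷ xs) rewrite sumOver-+ f g xs = lemma (f x) (g x) (sumOver f xs) (sumOver g xs)
  where lemma : ∀ a b u v → a + b + (u + v) ≡ a + u + (b + v)
        lemma = solve-∀ ℚ-ring

sumOver-*-+ : ∀ c f g xs → sumOver (λ x → c * f x + g x) xs ≡ c * sumOver f xs + sumOver g xs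
sumOver-*-+ c f g []       = sym (trans (cong (_+ 0ℚ) (ℚP.*-zeroʳ c)) (ℚP.+-identityʳ 0ℚ))
sumOver-*-+ c f g (x ∷ xs) rewrite sumOver-*-+ c f g xs = lemma c (f x) (g x) (sumOver f xs) (sumOver g xs)
  where lemma : ∀ c a b u v → c * a + b + (c * u + v) ≡ c * (a + u) + (b + v)
        lemma = solve-∀ ℚ-ring

prependOrMerge : ℕ → List (ℕ × List ℕ) → List (ℕ × List ℕ)
prependOrMerge k []             = []
prependOrMerge k ((h , t) ∷ xs) = (k , h ∷ t) ∷ (k ℕ.+ h , t) ∷ prependOrMerge k xs

-- The index lists obtained from k ∷ ks by summing runs of consecutive entries.
mergings : ℕ → List ℕ → List (ℕ × List ℕ)
mergings k []        = (k , []) ∷ []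
mergings k (k′ ∷ ks) = prependOrMerge k (mergings k′ ks)

sumOver-prependOrMerge : ∀ g k xs →
  sumOver g (prependOrMerge k xs) ≡ sumOver (λ { (h , t) → g (k , h ∷ t) + g (k ℕ.+ h , t) }) xs
sumOver-prependOrMerge g k []             = refl
sumOver-prependOrMerge g k ((h , t) ∷ xs) rewrite sumOver-prependOrMerge g k xs =
  sym (ℚP.+-assoc (g (k , h ∷ t)) (g (k ℕ.+ h , t)) _)

sumOver-mergings-suc : ∀ g k ks →
  sumOver g (mergings (suc k) ks) ≡ sumOver (λ { (h , t) → g (suc h , t) }) (mergings k ks)
sumOver-mergings-suc g k []        = refl
sumOver-mergings-suc g k (k′ ∷ ks) =
  trans (sumOver-prependOrMerge g (suc k) (mergings k′ ks)) (sym (sumOver-prependOrMerge _ k (mergings k′ ks)))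

ζ⋆N-singleton : ∀ N k → ζ⋆N N (k ∷ []) ≡ ζN N (k ∷ [])
ζ⋆N-singleton zero    k = refl
ζ⋆N-singleton (suc N) k = cong (λ z → inv^ N k * 1ℚ + z) (ζ⋆N-singleton N k)

ζ⋆N-mergings : ∀ ks N k → ζ⋆N N (k ∷ ks) ≡ sumOver (λ { (h , t) → ζN N (h ∷ t) }) (mergings k ks)
ζ⋆N-mergings []        N       k = trans (ζ⋆N-singleton N k) (sym (ℚP.+-identityʳ _))
ζ⋆N-mergings (k′ ∷ ks) zero    k =
  sym (trans (sumOver-prependOrMerge _ k (mergings k′ ks)) (sumOver-zero (λ _ → refl) (mergings k′ ks)))
ζ⋆N-mergings (k′ ∷ ks) (suc N) k = begin
    inv^ N k * ζ⋆N (suc N) (k′ ∷ ks) + ζ⋆N N (k ∷ k′ ∷ ks)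
  ≡⟨ cong₂ (λ a b → inv^ N k * a + b) (ζ⋆N-mergings ks (suc N) k′) (ζ⋆N-mergings (k′ ∷ ks) N k) ⟩
    inv^ N k * sumOver (ζ⁺ (suc N)) Ms + sumOver (ζ⁺ N) (prependOrMerge k Ms)
  ≡⟨ cong (inv^ N k * sumOver (ζ⁺ (suc N)) Ms +_) (sumOver-prependOrMerge (ζ⁺ N) k Ms) ⟩
    inv^ N k * sumOver (ζ⁺ (suc N)) Ms + sumOver (split (ζ⁺ N)) Ms
  ≡⟨ sym (sumOver-*-+ (inv^ N k) (ζ⁺ (suc N)) (split (ζ⁺ N)) Ms) ⟩
    sumOver (λ x → inv^ N k * ζ⁺ (suc N) x + split (ζ⁺ N) x) Ms
  ≡⟨ sumOver-cong step Ms ⟩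
    sumOver (split (ζ⁺ (suc N))) Ms
  ≡⟨ sym (sumOver-prependOrMerge (ζ⁺ (suc N)) k Ms) ⟩
    sumOver (ζ⁺ (suc N)) (prependOrMerge k Ms) ∎
  where
  open ≡-Reasoning
  Ms = mergings k′ ks
  ζ⁺ : ℕ → ℕ × List ℕ → ℚ
  ζ⁺ N (h , t) = ζN N (h ∷ t)
  split : (ℕ × List ℕ → ℚ) → ℕ × List ℕ → ℚ
  split g (h , t) = g (k , h ∷ t) + g (k ℕ.+ h , t)
  step : ∀ x → inv^ N k * ζ⁺ (suc N) x + split (ζ⁺ N) x ≡ split (ζ⁺ (suc N)) x
  step (h , t) = trans (lemma (inv^ N k) (inv^ N h) (ζN N t) (ζN N (h ∷ t)) (ζN N (k ∷ h ∷ t)) (ζN N ((k ℕ.+ h) ∷ t)))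
    (cong (λ z → inv^ N k * ζN N (h ∷ t) + ζN N (k ∷ h ∷ t) + (z * ζN N t + ζN N ((k ℕ.+ h) ∷ t))) (inv^-+ N k h))
    where lemma : ∀ a b z u v w → a * (b * z + u) + (v + w) ≡ a * u + v + (a * b * z + w)
          lemma = solve-∀ ℚ-ring

incHead : Maybe (List ℕ) → Maybe (List ℕ)
incHead (just (k ∷ ks)) = just (suc k ∷ ks)
incHead _               = nothing

indices-X : ∀ w → indices (X ∷ w) ≡ incHead (indices w)
indices-X w with indices w
... | just (k ∷ ks) = refl
... | just []       = refl
... | nothing       = refl

indices-Y : ∀ w → indices (Y ∷ w) ≡ Maybe.map (1 ∷_) (indices w)
indices-Y w with indices w
... | just ks = refl
... | nothing = refl

indices≡[]⇒≡[] : ∀ w → indices w ≡ just [] → w ≡ []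
indices≡[]⇒≡[] []      _ = refl
indices≡[]⇒≡[] (X ∷ w) e rewrite indices-X w with indices w
indices≡[]⇒≡[] (X ∷ w) () | just (_ ∷ _)
indices≡[]⇒≡[] (X ∷ w) () | just []
indices≡[]⇒≡[] (X ∷ w) () | nothing
indices≡[]⇒≡[] (Y ∷ w) e rewrite indices-Y w with indices w
indices≡[]⇒≡[] (Y ∷ w) () | just _
indices≡[]⇒≡[] (Y ∷ w) () | nothing

indices≡∷⇒EndsY : ∀ w k ks → indices w ≡ just (k ∷ ks) → EndsY w
indices≡∷⇒EndsY []      k ks ()
indices≡∷⇒EndsY (X ∷ w) k ks e rewrite indices-X w with indices w in eq
indices≡∷⇒EndsY (X ∷ w) k ks e | just (k′ ∷ ks′) with indices≡∷⇒EndsY w k′ ks′ eq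
... | u , refl = X ∷ u , refl
indices≡∷⇒EndsY (X ∷ w) k ks () | just []
indices≡∷⇒EndsY (X ∷ w) k ks () | nothing
indices≡∷⇒EndsY (Y ∷ w) k ks e rewrite indices-Y w with indices w in eq
indices≡∷⇒EndsY (Y ∷ w) k ks e | just [] rewrite indices≡[]⇒≡[] w eq = [] , refl
indices≡∷⇒EndsY (Y ∷ w) k ks e | just (k′ ∷ ks′) with indices≡∷⇒EndsY w k′ ks′ eq
... | u , refl = Y ∷ u , refl
indices≡∷⇒EndsY (Y ∷ w) k ks () | nothing

indices-∷ʳX : ∀ u → indices (u L.∷ʳ X) ≡ nothing
indices-∷ʳX []      = refl
indices-∷ʳX (X ∷ u) rewrite indices-X (u L.∷ʳ X) | indices-∷ʳX u = refl
indices-∷ʳX (Y ∷ u) rewrite indices-Y (u L.∷ʳ X) | indices-∷ʳX u = refl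

indices-∷ʳY : ∀ u → ∃ λ k → ∃ λ ks → indices (u L.∷ʳ Y) ≡ just (k ∷ ks)
indices-∷ʳY []      = 1 , [] , refl
indices-∷ʳY (X ∷ u) with indices-∷ʳY u
... | k , ks , e rewrite indices-X (u L.∷ʳ Y) | e = suc k , ks , refl
indices-∷ʳY (Y ∷ u) with indices-∷ʳY u
... | k , ks , e rewrite indices-Y (u L.∷ʳ Y) | e = 1 , k ∷ ks , refl

atShifted : (List ℕ → ℚ) → ℕ → Maybe (List ℕ) → ℚ
atShifted F j       nothing         = 0ℚ
atShifted F j       (just (k ∷ ks)) = F ((j ℕ.+ k) ∷ ks)
atShifted F zero    (just [])       = F []
atShifted F (suc j) (just [])       = 0ℚ

-- F at the indices of xʲu (0 if xʲu does not end in y).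
atXʲ : (List ℕ → ℚ) → ℕ → Word → ℚ
atXʲ F j u = atShifted F j (indices u)

atXʲ-X : ∀ F j u → atXʲ F j (X ∷ u) ≡ atXʲ F (suc j) u
atXʲ-X F j u rewrite indices-X u with indices u
... | nothing       = refl
... | just []       = refl
... | just (k ∷ ks) = cong (λ i → F (i ∷ ks)) (ℕP.+-suc j k)

atXʲ-Y : ∀ F j u → atXʲ F j (Y ∷ u) ≡ atXʲ (λ ks → F (suc j ∷ ks)) 0 u
atXʲ-Y F j u rewrite indices-Y u with indices u
... | nothing       = refl
... | just []       = cong (λ i → F (i ∷ [])) (ℕP.+-comm j 1)
... | just (k ∷ ks) = cong (λ i → F (i ∷ k ∷ ks)) (ℕP.+-comm j 1)

extℚ-letter· : ∀ (g : Word → ℚ) l p → extℚ g (pure (l ∷ []) · p) ≡ extℚ (λ w → g (l ∷ w)) p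
extℚ-letter· g l p = begin
    extℚ g (scale 1ℚ lp ++ [])  ≡⟨ extℚ-++ g (scale 1ℚ lp) [] ⟩
    extℚ g (scale 1ℚ lp) + 0ℚ   ≡⟨ ℚP.+-identityʳ _ ⟩
    extℚ g (scale 1ℚ lp)        ≡⟨ extℚ-scale g 1ℚ lp ⟩
    1ℚ * extℚ g lp              ≡⟨ ℚP.*-identityˡ _ ⟩
    extℚ g lp                   ≡⟨ extℚ-ext g _ p ⟩
    extℚ (λ w → extℚ g (pure (l ∷ w))) p ≡⟨ extℚ-cong (λ w → extℚ-pure g (l ∷ w)) p ⟩
    extℚ (λ w → g (l ∷ w)) p    ∎
  where
  open ≡-Reasoning
  lp = ext (λ w → pure (l ∷ w)) p

dWith-γ-∷ : ∀ l w → EndsY w → dWith γL (l ∷ w) ≋H γL l · dWith γL w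
dWith-γ-∷ l w ey = ≋-trans (dWith-++ γL (l ∷ []) w ey) (·-respˡ (dWith γL w) (algMap-letter γL l))

-- Z_N ∘ d on a word z_{k}⋯ : the x's shift the first index, and γ(y) = x + y either
-- merges the next index into it or starts a new one.
extℚ-atXʲ-dWith-γ : ∀ w k ks → indices w ≡ just (k ∷ ks) → ∀ F j →
  extℚ (atXʲ F j) (dWith γL w) ≡ sumOver (λ { (h , t) → F ((j ℕ.+ h) ∷ t) }) (mergings k ks)
extℚ-atXʲ-dWith-γ [] k ks () F j
extℚ-atXʲ-dWith-γ (X ∷ w) k ks e F j rewrite indices-X w with indices w in eq
extℚ-atXʲ-dWith-γ (X ∷ w) .(suc k′) ks refl F j | just (k′ ∷ .ks) = begin
    extℚ (atXʲ F j) (dWith γL (X ∷ w))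
  ≡⟨ extℚ-cong-≋ (atXʲ F j) (dWith-γ-∷ X w (indices≡∷⇒EndsY w k′ ks eq)) ⟩
    extℚ (atXʲ F j) (xH · dWith γL w)
  ≡⟨ extℚ-letter· (atXʲ F j) X (dWith γL w) ⟩
    extℚ (λ u → atXʲ F j (X ∷ u)) (dWith γL w)
  ≡⟨ extℚ-cong (atXʲ-X F j) (dWith γL w) ⟩
    extℚ (atXʲ F (suc j)) (dWith γL w)
  ≡⟨ extℚ-atXʲ-dWith-γ w k′ ks eq F (suc j) ⟩
    sumOver (λ { (h , t) → F ((suc j ℕ.+ h) ∷ t) }) (mergings k′ ks)
  ≡⟨ sumOver-cong (λ { (h , t) → cong (λ i → F (i ∷ t)) (sym (ℕP.+-suc j h)) }) (mergings k′ ks) ⟩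
    sumOver (λ { (h , t) → F ((j ℕ.+ suc h) ∷ t) }) (mergings k′ ks)
  ≡⟨ sym (sumOver-mergings-suc (λ { (h , t) → F ((j ℕ.+ h) ∷ t) }) k′ ks) ⟩
    sumOver (λ { (h , t) → F ((j ℕ.+ h) ∷ t) }) (mergings (suc k′) ks) ∎
  where open ≡-Reasoning
extℚ-atXʲ-dWith-γ (X ∷ w) k ks () F j | just []
extℚ-atXʲ-dWith-γ (X ∷ w) k ks () F j | nothing
extℚ-atXʲ-dWith-γ (Y ∷ w) k ks e F j rewrite indices-Y w with indices w in eq
extℚ-atXʲ-dWith-γ (Y ∷ w) .1 .[] refl F j | just [] rewrite indices≡[]⇒≡[] w eq = begin
    extℚ (atXʲ F j) (dWith γL (Y ∷ []))  ≡⟨ extℚ-cong-≋ (atXʲ F j) (≋-trans (≡⇒≋ (dWith-∷ʳY γL [])) (·-identityˡ yH)) ⟩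
    extℚ (atXʲ F j) yH                   ≡⟨ extℚ-pure (atXʲ F j) (Y ∷ []) ⟩
    F ((j ℕ.+ 1) ∷ [])                   ≡⟨ sym (ℚP.+-identityʳ _) ⟩
    F ((j ℕ.+ 1) ∷ []) + 0ℚ              ∎
  where open ≡-Reasoning
extℚ-atXʲ-dWith-γ (Y ∷ w) .1 .(k′ ∷ ks′) refl F j | just (k′ ∷ ks′) = begin
    extℚ (atXʲ F j) (dWith γL (Y ∷ w))
  ≡⟨ extℚ-cong-≋ (atXʲ F j) (dWith-γ-∷ Y w (indices≡∷⇒EndsY w k′ ks′ eq)) ⟩
    extℚ (atXʲ F j) (zH · q)
  ≡⟨ cong (extℚ (atXʲ F j)) (ext-++ (λ a → ext (λ b → pure (a ++ b)) q) xH yH) ⟩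
    extℚ (atXʲ F j) ((xH · q) ++ (yH · q))
  ≡⟨ extℚ-++ (atXʲ F j) (xH · q) (yH · q) ⟩
    extℚ (atXʲ F j) (xH · q) + extℚ (atXʲ F j) (yH · q)
  ≡⟨ cong₂ _+_ (extℚ-letter· (atXʲ F j) X q) (extℚ-letter· (atXʲ F j) Y q) ⟩
    extℚ (λ u → atXʲ F j (X ∷ u)) q + extℚ (λ u → atXʲ F j (Y ∷ u)) q
  ≡⟨ cong₂ _+_ (extℚ-cong (atXʲ-X F j) q) (extℚ-cong (atXʲ-Y F j) q) ⟩
    extℚ (atXʲ F (suc j)) q + extℚ (atXʲ F′ 0) q
  ≡⟨ cong₂ _+_ (extℚ-atXʲ-dWith-γ w k′ ks′ eq F (suc j)) (extℚ-atXʲ-dWith-γ w k′ ks′ eq F′ 0) ⟩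
    sumOver (λ { (h , t) → F ((suc j ℕ.+ h) ∷ t) }) Ms + sumOver (λ { (h , t) → F′ (h ∷ t) }) Ms
  ≡⟨ sym (sumOver-+ _ _ Ms) ⟩
    sumOver (λ { (h , t) → F ((suc j ℕ.+ h) ∷ t) + F′ (h ∷ t) }) Ms
  ≡⟨ sumOver-cong (λ { (h , t) → merge-or-split h t }) Ms ⟩
    sumOver (λ { (h , t) → F ((j ℕ.+ 1) ∷ h ∷ t) + F ((j ℕ.+ (1 ℕ.+ h)) ∷ t) }) Ms
  ≡⟨ sym (sumOver-prependOrMerge (λ { (h , t) → F ((j ℕ.+ h) ∷ t) }) 1 Ms) ⟩
    sumOver (λ { (h , t) → F ((j ℕ.+ h) ∷ t) }) (prependOrMerge 1 Ms) ∎
  where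
  open ≡-Reasoning
  q  = dWith γL w
  Ms = mergings k′ ks′
  F′ : List ℕ → ℚ
  F′ ks = F (suc j ∷ ks)
  merge-or-split : ∀ h t → F ((suc j ℕ.+ h) ∷ t) + F′ (h ∷ t) ≡ F ((j ℕ.+ 1) ∷ h ∷ t) + F ((j ℕ.+ (1 ℕ.+ h)) ∷ t)
  merge-or-split h t = trans (ℚP.+-comm (F ((suc j ℕ.+ h) ∷ t)) (F (suc j ∷ h ∷ t)))
    (cong₂ (λ a b → F (a ∷ h ∷ t) + F (b ∷ t)) (ℕP.+-comm 1 j) (sym (ℕP.+-suc j h)))
extℚ-atXʲ-dWith-γ (Y ∷ w) k ks () F j | nothing

onIndices-just : ∀ (f : ℕ → List ℕ → ℚ) N w ks → indices w ≡ just ks → onIndices f N w ≡ f N ks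
onIndices-just f N w ks e with indices w
onIndices-just f N w ks refl | just .ks = refl

onIndices-nothing : ∀ (f : ℕ → List ℕ → ℚ) N w → indices w ≡ nothing → onIndices f N w ≡ 0ℚ
onIndices-nothing f N w e with indices w
onIndices-nothing f N w refl | nothing = refl

onIndices≡atX⁰ : ∀ N u → onIndices ζN N u ≡ atXʲ (ζN N) 0 u
onIndices≡atX⁰ N u with indices u
... | nothing      = refl
... | just []      = refl
... | just (_ ∷ _) = refl

onIndices-ζ⋆N-dW : ∀ N w → onIndices ζ⋆N N w ≡ extℚ (onIndices ζN N) (dW w)
onIndices-ζ⋆N-dW N w with L.initLast w
... | []      = sym (extℚ-pure (onIndices ζN N) [])
... | u ∷ʳ′ X = onIndices-nothing ζ⋆N N (u L.∷ʳ X) (indices-∷ʳX u)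
... | u ∷ʳ′ Y with indices-∷ʳY u
...   | k , ks , e = begin
    onIndices ζ⋆N N (u L.∷ʳ Y)                            ≡⟨ onIndices-just ζ⋆N N (u L.∷ʳ Y) (k ∷ ks) e ⟩
    ζ⋆N N (k ∷ ks)                                        ≡⟨ ζ⋆N-mergings ks N k ⟩
    sumOver (λ { (h , t) → ζN N (h ∷ t) }) (mergings k ks) ≡⟨ sym (extℚ-atXʲ-dWith-γ (u L.∷ʳ Y) k ks e (ζN N) 0) ⟩
    extℚ (atXʲ (ζN N) 0) (dWith γL (u L.∷ʳ Y))            ≡⟨ sym (extℚ-cong (onIndices≡atX⁰ N) (dWith γL (u L.∷ʳ Y))) ⟩
    extℚ (onIndices ζN N) (dWith γL (u L.∷ʳ Y))            ≡⟨ cong (extℚ (onIndices ζN N)) (dWith-∷ʳY γL u) ⟩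
    extℚ (onIndices ζN N) (γW u · yH)                      ∎
  where open ≡-Reasoning

Z̄N≡ZN∘d : ∀ N p → Z̄N N p ≡ ZN N (d p)
Z̄N≡ZN∘d N p = trans (extℚ-cong (onIndices-ζ⋆N-dW N) p) (sym (extℚ-ext (onIndices ζN N) dW p))

Z̄N-ZN∘d-tendsTo0 : ∀ p → TendsToZero (λ N → Z̄N N p - ZN N (d p))
Z̄N-ZN∘d-tendsTo0 p ε ε>0 = 0 , λ N _ → subst (λ δ → ℚ.∣ δ ∣ ℚ.< ε) (sym (Z̄N-ZN∘d≡0 N)) ε>0
  where
  Z̄N-ZN∘d≡0 : ∀ N → Z̄N N p - ZN N (d p) ≡ 0ℚ
  Z̄N-ZN∘d≡0 N = trans (cong (_- ZN N (d p)) (Z̄N≡ZN∘d N p)) (ℚP.+-inverseʳ (ZN N (d p)))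

proposition6p8 : ∀ (n : ℕ) →
      -- 𝒞_n(𝔥) and 𝒞̄_n(𝔥) lie in x𝔥 ⊗ 𝔥^{⊗n} ⊗ 𝔥y
      (∀ (p : H) → InSub (C n p) × InSub (Cbar n p))
      -- γ ⊗ γ^{⊗n} ⊗ d is a ℚ-linear automorphism of x𝔥 ⊗ 𝔥^{⊗n} ⊗ 𝔥y
    × (∀ (t : T n) → InSub t → InSub (Φ t))
    × (∀ (s t : T n) → InSub s → InSub t → Φ s ≈T Φ t → s ≈T t)
    × (∀ (t : T n) → InSub t → ∃ λ (s : T n) → InSub s × Φ s ≈T t)
      -- d restricts to a ℚ-linear automorphism of 𝔥⁰
    × (∀ (p : H) → InH0 p → InH0 (d p))
    × (∀ (p q : H) → InH0 p → InH0 q → d p ≈H d q → p ≈H q)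
    × (∀ (q : H) → InH0 q → ∃ λ (p : H) → InH0 p × d p ≈H q)
      -- (i)
    × (∀ (p : H) → Φ (Cbar n p) ≈T C n p)
      -- (ii)
    × (∀ (t : T n) → InSub t → d (M t) ≈H M (Φ t))
      -- (iii)
    × (∀ (p : H) → d (ρbar n p) ≈H ρ n p)
      -- (iv)  Z̄(p) = Z(d p) for p ∈ 𝔥⁰, i.e. the partial sums have the same limit
    × (∀ (p : H) → InH0 p → TendsToZero (λ N → Z̄N N p - ZN N (d p)))
proposition6p8 n =
    (λ p → C-InSub n p , Cbar-InSub n p)
  , Φ-InSub n
  , Φ-injective-InSub n
  , Φ-surjective-InSub n
  , d-𝔥⁰
  , d-injective-𝔥⁰
  , d-surjective-𝔥⁰
  , (λ p → coeff-≡ (Φ-Cbar n p))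
  , (λ t t∈Sub → coeff-≡ (d-M n t t∈Sub))
  , (λ p → coeff-≡ (d-ρbar n p))
  , (λ p _ → Z̄N-ZN∘d-tendsTo0 p)
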